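{- Let $T$ be a connected caterpillar with $m_t(T)\le 5$. Then $\varphi_t(T)=m_t(T)$.
   Context: A caterpillar is a tree $T$ having a central path $\mathcal{P}$ (the path formed by its non-leaf vertices; empty if $T\cong K_1$ or $K_2$) such that every leaf of $T$ is at distance one from $\mathcal{P}$. For a simple graph $G=(V,E)$: elements are members of $V\cup E$; two elements are adjacent if they are adjacent vertices, a vertex and an edge incident to it, or two distinct edges sharing an endpoint. $N_t(x)$ is the set of elements adjacent to $x$ and $d_t(x)=|N_t(x)|$ (so $d_t(v)=2d(v)$ for a vertex, $d_t(uv)=d(u)+d(v)$ for an edge). A total $k$-colouring is a surjective map $\mathbf{c}:V\cup E\to\{1,\dots,k\}$ giving adjacent elements different colours. An element $x$ is total b-chromatic if $\mathbf{c}(N_t(x))=\{1,\dots,k\}\setminus\{\mathbf{c}(x)\}$; a total b-chromatic $k$-colouring has a total b-chromatic element in every colour class; $\varphi_t(G)$ is the maximum such $k$. With elements ordered by non-increasing total degree $d_t(x_1)\ge d_t(x_2)\ge\cdots$, the total $m$-degree is $m_t(G)=\max\{i: d_t(x_i)\ge i-1\}$. -}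

module Defs where

open import Data.Nat using (ℕ; zero; suc; _≤_; _≤ᵇ_; _⊔_)
open import Data.Nat.Properties using (≤-decTotalOrder)
open import Data.Bool using (_≟_; Bool; true; false; _∨_; _∧_; not; if_then_else_)
open import Data.Fin using (Fin) renaming (_<_ to _<ᶠ_; _≟_ to _≟ᶠ_; _<?_ to _<?ᶠ_)
open import Data.List using (List; []; _∷_; length; filterᵇ; map; _++_; concatMap; mapMaybe; reverse)
open import Data.List.Membership.Propositional using (_∈_)
open import Data.List.Relation.Unary.Unique.Propositional using (Unique)
open import Data.List.Relation.Unary.Linked using (Linked)
open import Data.Empty using (⊥)
open import Data.List.Sort.InsertionSort.Base ≤-decTotalOrder using (sort)
open import Data.Maybe using (Maybe; just; nothing)
open import Data.Product using (Σ; Σ-syntax; ∃; ∃-syntax; _×_; _,_; proj₁; proj₂)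
open import Data.Sum using (_⊎_; inj₁; inj₂)
open import Data.List using () renaming (allFin to allFinL)
open import Relation.Nullary using (¬_; yes; no; does)
open import Relation.Binary.PropositionalEquality using (_≡_; _≢_)
open import Function.Bundles using (_⇔_)

record Graph : Set where
  field
    n      : ℕ
    adj    : Fin n → Fin n → Bool
    sym    : ∀ u v → adj u v ≡ adj v u
    irrefl : ∀ u → adj u u ≡ false

module _ (G : Graph) where
  open Graph G

  Vertex : Set
  Vertex = Fin n

  -- An edge uv is stored once, as an ordered pair (u , v) with u < v.
  Edge : Set
  Edge = Σ[ p ∈ Fin n × Fin n ] ((proj₁ p <ᶠ proj₂ p) × (adj (proj₁ p) (proj₂ p) ≡ true))

  Element : Set
  Element = Vertex ⊎ Edge

  private
    eqᵇ : Fin n → Fin n → Bool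
    eqᵇ u v = does (u ≟ᶠ v)

  adjElem : Element → Element → Bool
  adjElem (inj₁ u) (inj₁ v) = adj u v
  adjElem (inj₁ w) (inj₂ ((u , v) , _)) = eqᵇ w u ∨ eqᵇ w v
  adjElem (inj₂ ((u , v) , _)) (inj₁ w) = eqᵇ w u ∨ eqᵇ w v
  adjElem (inj₂ ((a , b) , _)) (inj₂ ((c , d) , _)) =
    not (eqᵇ a c ∧ eqᵇ b d) ∧ (eqᵇ a c ∨ eqᵇ a d ∨ eqᵇ b c ∨ eqᵇ b d)

  vertices : List Vertex
  vertices = allFinL n

  private
    mkEdge : Fin n → Fin n → Maybe Edge
    mkEdge u v with u <?ᶠ v | adj u v ≟ true
    ... | yes u<v | yes a = just ((u , v) , (u<v , a))
    ... | _       | _     = nothing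

  edges : List Edge
  edges = concatMap (λ u → mapMaybe (mkEdge u) vertices) vertices

  elements : List Element
  elements = map inj₁ vertices ++ map inj₂ edges

  deg : Vertex → ℕ
  deg v = length (filterᵇ (adj v) vertices)

  degT : Element → ℕ
  degT x = length (filterᵇ (adjElem x) elements)

  -- Total m-degree.  Sort the total degrees non-increasingly
  -- d_t(x_1) ≥ d_t(x_2) ≥ ⋯ and take max { i : d_t(x_i) ≥ i - 1 }
  -- (0 if there are no elements).

  private
    -- mgo j ds : ds is the suffix starting at position j+1 (1-based),
    -- returns max { i : i ≥ j+1, d_i ≥ i-1 } (or 0 if none).
    mgo : ℕ → List ℕ → ℕ
    mgo j [] = 0
    mgo j (d ∷ ds) = (if j ≤ᵇ d then suc j else 0) ⊔ mgo (suc j) ds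

  sortedDegT : List ℕ
  sortedDegT = reverse (sort (map degT elements))

  mT : ℕ
  mT = mgo 0 sortedDegT

  IsTotalColouring : (k : ℕ) → (Element → Fin k) → Set
  IsTotalColouring k c =
    (∀ j → ∃[ x ] c x ≡ j) ×
    (∀ x y → adjElem x y ≡ true → c x ≢ c y)

  IsTotalBChromaticElem : (k : ℕ) → (Element → Fin k) → Element → Set
  IsTotalBChromaticElem k c x =
    ∀ j → (j ≢ c x) ⇔ (∃[ y ] (adjElem x y ≡ true × c y ≡ j))

  IsTotalBChromaticColouring : (k : ℕ) → (Element → Fin k) → Set
  IsTotalBChromaticColouring k c =
    IsTotalColouring k c ×
    (∀ j → ∃[ x ] (c x ≡ j × IsTotalBChromaticElem k c x))

  HasTotalBChromaticColouring : ℕ → Set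
  HasTotalBChromaticColouring k =
    Σ[ c ∈ (Element → Fin k) ] IsTotalBChromaticColouring k c

  TotalBChromaticNumberIs : ℕ → Set
  TotalBChromaticNumberIs k =
    HasTotalBChromaticColouring k ×
    (∀ k' → HasTotalBChromaticColouring k' → k' ≤ k)

  Adj : Vertex → Vertex → Set
  Adj u v = adj u v ≡ true

  IsPath : List Vertex → Set
  IsPath ps = Unique ps × Linked Adj ps

  lastOr : Vertex → List Vertex → Vertex
  lastOr a []       = a
  lastOr a (b ∷ bs) = lastOr b bs

  Connected : Set
  Connected =
    (1 ≤ n) × (∀ u v → ∃[ ps ] (IsPath (u ∷ ps) × lastOr u ps ≡ v))

  IsCycle : List Vertex → Set
  IsCycle []       = ⊥
  IsCycle (u ∷ ps) = IsPath (u ∷ ps) × (2 ≤ length ps) × Adj (lastOr u ps) u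

  Acyclic : Set
  Acyclic = ∀ cs → ¬ IsCycle cs

  IsTree : Set
  IsTree = Connected × Acyclic

  -- A caterpillar: a tree whose non-leaf vertices (degree ≥ 2) form a
  -- path P (the central path; empty iff T ≅ K₁ or K₂) such that every
  -- leaf is at distance one from P.
  IsCaterpillar : Set
  IsCaterpillar =
    IsTree ×
    (∃[ P ] (IsPath P
            × (∀ v → (v ∈ P) ⇔ (2 ≤ deg v))
            × (∀ v → deg v ≡ 1 → (P ≡ []) ⊎ (∃[ u ] (u ∈ P × Adj u v)))))

-- φ_t ≤ m_t holds in every graph: an element that sees every colour but its own has total degree at
-- least k − 1, so the k such elements of a total b-chromatic k-colouring show m_t ≥ k.
--
-- For the converse, distinguish caterpillars by the number s of vertices of their spine P.  For s = 0 it is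
-- K₁ or K₂, for s = 1 a star with a ≥ 2 leaves, and for s = 2 with one leaf at each end the path P₄;
-- an explicit colouring with 1, 3, a + 1 and 4 colours is total b-chromatic, and the elements of large
-- total degree can be listed, which bounds m_t by the same number.  In all other cases a total
-- b-chromatic 5-colouring exists, so m_t = 5 by the hypothesis m_t ≤ 5.  That hypothesis is what makes the
-- colouring possible: a vertex and its d incident edges are d + 1 elements of total degree at least d,
-- so every degree is at most 4, and a spine vertex carries at most 3 leaves (at most 2 inside the spine).

module Submission where

open import Defs

open import Axiom.UniquenessOfIdentityProofs using (module Decidable⇒UIP)
open import Data.Bool as Bool using (Bool; true; false; T; T?; if_then_else_)
open import Data.Bool.Properties using (T-≡)
open import Data.Empty using (⊥-elim)
open import Data.Fin as Fin using (Fin; zero; suc; toℕ)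
import Data.Fin.Properties as Fin
open import Data.Fin.Properties using (toℕ-fromℕ<; toℕ-injective; toℕ<n)
open import Data.List using (List; []; _∷_; [_]; length; filter; filterᵇ; map; _++_; concatMap; mapMaybe; allFin; reverse)
open import Data.List.Properties using (length-++; length-map; length-tabulate; length-filter; unfold-reverse)
open import Data.List.Membership.Propositional using (_∈_; _∉_)
open import Data.List.Membership.Propositional.Properties
  using (∈-filter⁺; ∈-filter⁻; ∈-∃++; ∈-++⁻; ∈-++⁺ˡ; ∈-++⁺ʳ; ∈-map⁺; ∈-map⁻; ∈-concatMap⁺; ∈-allFin)
open import Data.List.Relation.Unary.All as All using (All; []; _∷_)
import Data.List.Relation.Unary.All.Properties as All
open import Data.List.Relation.Unary.Any as Any using (here; there)
import Data.List.Relation.Unary.Any.Properties as Any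
open import Data.List.Relation.Unary.AllPairs as AllPairs using (AllPairs; []; _∷_)
import Data.List.Relation.Unary.AllPairs.Properties as AllPairs
open import Data.List.Relation.Unary.Linked as Linked using (Linked; []; [-]; _∷_)
open import Data.List.Relation.Unary.Linked.Properties using (Linked⇒AllPairs)
open import Data.List.Relation.Unary.Unique.Propositional using (Unique)
import Data.List.Relation.Unary.Unique.Propositional.Properties as Unique
open import Data.List.Relation.Binary.Permutation.Propositional using (↭-trans)
open import Data.List.Relation.Binary.Permutation.Propositional.Properties using (↭-length; filter-↭; ↭-reverse)
import Data.List.Sort.InsertionSort.Base as InsertionSort
import Data.List.Sort.InsertionSort.Properties as InsertionSort
open import Data.Maybe using (Maybe; just; nothing)
open import Data.Nat using (ℕ; zero; suc; _+_; _≟_; _≤_; _<_; _≤ᵇ_; _⊔_; _⊓_; z≤n; s≤s)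
open import Data.Nat.DivMod using (_mod_; m<n⇒m%n≡m)
open import Data.Nat.Properties
  using (≤-decTotalOrder; _≤?_; ≤-trans; ≤-reflexive; ≤-pred; ≤-antisym; ≤-total; <-≤-trans; <-irrefl; <-trans; ≮⇒≥; ≰⇒>;
         ≤∧≢⇒<; m≤n⇒m<n∨m≡n; n≤1+n; n<1+n; suc-injective; +-suc; +-identityʳ; ≤ᵇ-reflects-≤;
         m≤m⊔n; m≤n⇒m≤o⊔n; m≤n⇒m⊔n≡n; m≥n⇒m⊔n≡m; ⊓-comm; m≤n⇒m⊓n≡m; m≥n⇒m⊓n≡n; module ≤-Reasoning)
open import Data.Product as Product using (Σ; ∃-syntax; _×_; _,_; proj₁; proj₂)
open import Data.Sum as Sum using (_⊎_; inj₁; inj₂; [_,_]′)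
open import Data.Sum.Properties using (inj₁-injective; inj₂-injective)
open import Data.Unit using (⊤; tt)
open import Function using (_∘_; flip; id)
open import Function.Bundles using (Equivalence; _⇔_; mk⇔)
open import Relation.Binary.Definitions using (DecidableEquality; tri<; tri≈; tri>)
open import Relation.Binary.PropositionalEquality
  using (_≡_; _≢_; ≢-sym; refl; sym; trans; cong; cong₂; subst; subst₂; module ≡-Reasoning)
open import Relation.Nullary using (¬_; Dec; yes; no; contradiction; ofʸ; ofⁿ; ¬?; _×-dec_; _⊎-dec_)
open import Relation.Nullary.Decidable using (from-yes; True; toWitness)

module _ {A : Set} (p : A → Bool) where

  ∈-filterᵇ⁺ : ∀ {x xs} → x ∈ xs → p x ≡ true → x ∈ filterᵇ p xs
  ∈-filterᵇ⁺ x∈xs px = ∈-filter⁺ (T? ∘ p) x∈xs (Equivalence.from T-≡ px)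

  ∈-filterᵇ⁻ : ∀ {x} xs → x ∈ filterᵇ p xs → x ∈ xs × p x ≡ true
  ∈-filterᵇ⁻ xs x∈ = Product.map₂ (Equivalence.to T-≡) (∈-filter⁻ (T? ∘ p) {xs = xs} x∈)

  Unique-filterᵇ⁺ : ∀ {xs} → Unique xs → Unique (filterᵇ p xs)
  Unique-filterᵇ⁺ = Unique.filter⁺ (T? ∘ p)

module _ {A B : Set} (f : A → Maybe B) where

  ∈-mapMaybe⁺ : ∀ {x y xs} → x ∈ xs → f x ≡ just y → y ∈ mapMaybe f xs
  ∈-mapMaybe⁺ {xs = x′ ∷ xs} (here refl) fx≡y with f x′
  ∈-mapMaybe⁺ {xs = x′ ∷ xs} (here refl) refl | just _ = here refl
  ∈-mapMaybe⁺ {xs = x′ ∷ xs} (there x∈xs) fx≡y with f x′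
  ... | just _  = there (∈-mapMaybe⁺ x∈xs fx≡y)
  ... | nothing = ∈-mapMaybe⁺ x∈xs fx≡y

  ∈-mapMaybe⁻ : ∀ {y} xs → y ∈ mapMaybe f xs → ∃[ x ] x ∈ xs × f x ≡ just y
  ∈-mapMaybe⁻ (x ∷ xs) y∈ with f x in fx≡
  ∈-mapMaybe⁻ (x ∷ xs) (here refl)  | just _  = x , here refl , fx≡
  ∈-mapMaybe⁻ (x ∷ xs) (there y∈)   | just _  = Product.map₂ (Product.map₁ there) (∈-mapMaybe⁻ xs y∈)
  ∈-mapMaybe⁻ (x ∷ xs) y∈           | nothing = Product.map₂ (Product.map₁ there) (∈-mapMaybe⁻ xs y∈)

  Unique-mapMaybe⁺ : (∀ {x x′ y} → f x ≡ just y → f x′ ≡ just y → x ≡ x′) → ∀ {xs} → Unique xs → Unique (mapMaybe f xs)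
  Unique-mapMaybe⁺ f-inj {[]} [] = []
  Unique-mapMaybe⁺ f-inj {x ∷ xs} (x∉xs ∷ xs!) with f x in fx≡
  ... | nothing = Unique-mapMaybe⁺ f-inj xs!
  ... | just y  = All.tabulate y∉ ∷ Unique-mapMaybe⁺ f-inj xs!
    where
    y∉ : ∀ {z} → z ∈ mapMaybe f xs → y ≢ z
    y∉ z∈ refl with ∈-mapMaybe⁻ xs z∈
    ... | x′ , x′∈xs , fx′≡ = All.lookup x∉xs x′∈xs (f-inj fx≡ fx′≡)

Unique-concatMap⁺ : ∀ {A B : Set} (g : A → List B) → (∀ {x x′ z} → z ∈ g x → z ∈ g x′ → x ≡ x′) →
                    (∀ x → Unique (g x)) → ∀ {xs} → Unique xs → Unique (concatMap g xs)
Unique-concatMap⁺ g disjoint g! xs! =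
  Unique.concat⁺ (All.map⁺ (All.universal g! _))
                 (AllPairs.map⁺ {f = g} (AllPairs.map (λ x≢x′ {_} (z∈ , z∈′) → x≢x′ (disjoint z∈ z∈′)) xs!))

Unique-map-on⁺ : ∀ {A B : Set} (f : A → B) {xs} → (∀ {x x′} → x ∈ xs → x′ ∈ xs → f x ≡ f x′ → x ≡ x′) →
                 Unique xs → Unique (map f xs)
Unique-map-on⁺ f {[]} f-inj [] = []
Unique-map-on⁺ f {x ∷ xs} f-inj (x∉xs ∷ xs!) =
  All.tabulate fx∉ ∷ Unique-map-on⁺ f (λ x∈ x′∈ → f-inj (there x∈) (there x′∈)) xs!
  where
  fx∉ : ∀ {z} → z ∈ map f xs → f x ≢ z
  fx∉ z∈ fx≡z with x′ , x′∈xs , refl ← ∈-map⁻ f z∈ = All.lookup x∉xs x′∈xs (f-inj (here refl) (there x′∈xs) fx≡z)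

Unique-⊆⇒length≤ : ∀ {A : Set} {xs ys : List A} → Unique xs → (∀ {z} → z ∈ xs → z ∈ ys) → length xs ≤ length ys
Unique-⊆⇒length≤ {xs = []} _ _ = z≤n
Unique-⊆⇒length≤ {xs = x ∷ xs} (x∉xs ∷ xs!) xs⊆ys with us , vs , refl ← ∈-∃++ (xs⊆ys (here refl)) = begin
  suc (length xs)          ≤⟨ s≤s (Unique-⊆⇒length≤ xs! xs⊆us++vs) ⟩
  suc (length (us ++ vs))  ≡⟨ cong suc (length-++ us) ⟩
  suc (length us + length vs) ≡⟨ sym (+-suc (length us) (length vs)) ⟩
  length us + length (x ∷ vs) ≡⟨ sym (length-++ us) ⟩
  length (us ++ x ∷ vs)    ∎
  where
  open ≤-Reasoning
  xs⊆us++vs : ∀ {z} → z ∈ xs → z ∈ us ++ vs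
  xs⊆us++vs z∈xs with ∈-++⁻ us (xs⊆ys (there z∈xs))
  ... | inj₁ z∈us         = ∈-++⁺ˡ z∈us
  ... | inj₂ (here refl)  = ⊥-elim (All.lookup x∉xs z∈xs refl)
  ... | inj₂ (there z∈vs) = ∈-++⁺ʳ us z∈vs

AllPairs-reverse⁺ : ∀ {A : Set} {R : A → A → Set} {xs} → AllPairs R xs → AllPairs (flip R) (reverse xs)
AllPairs-reverse⁺ {xs = []} [] = []
AllPairs-reverse⁺ {xs = x ∷ xs} (Rx ∷ Rxs) rewrite unfold-reverse x xs =
  AllPairs.++⁺ (AllPairs-reverse⁺ Rxs) ([] ∷ []) (All.tabulate (λ y∈ → All.lookup Rx (Any.reverse⁻ y∈) ∷ []))

module _ {A : Set} (p : A → Bool) {xs : List A} where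

  length-filterᵇ-≥ : (∀ z → z ∈ xs) → ∀ {zs} → Unique zs → (∀ {z} → z ∈ zs → p z ≡ true) → length zs ≤ length (filterᵇ p xs)
  length-filterᵇ-≥ complete zs! pzs = Unique-⊆⇒length≤ zs! (λ z∈ → ∈-filterᵇ⁺ p (complete _) (pzs z∈))

  length-filterᵇ-≤ : Unique xs → ∀ {L} → (∀ {z} → p z ≡ true → z ∈ L) → length (filterᵇ p xs) ≤ length L
  length-filterᵇ-≤ xs! p⊆L = Unique-⊆⇒length≤ (Unique-filterᵇ⁺ p xs!) (λ z∈ → p⊆L (proj₂ (∈-filterᵇ⁻ p xs z∈)))

lookupOr : ∀ {A : Set} → A → List A → ℕ → A
lookupOr d [] _ = d
lookupOr d (x ∷ xs) zero = x
lookupOr d (x ∷ xs) (suc i) = lookupOr d xs i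

lookupOr-∈ : ∀ {A : Set} (d : A) {xs} i → i < length xs → lookupOr d xs i ∈ xs
lookupOr-∈ d {x ∷ xs} zero _ = here refl
lookupOr-∈ d {x ∷ xs} (suc i) (s≤s i<) = there (lookupOr-∈ d i i<)

module _ {A : Set} (_≟_ : DecidableEquality A) where

  position : A → List A → ℕ
  position x [] = 0
  position x (y ∷ ys) with x ≟ y
  ... | yes _ = 0
  ... | no _  = suc (position x ys)

  position-< : ∀ {x ys} → x ∈ ys → position x ys < length ys
  position-< {x} {y ∷ ys} x∈ with x ≟ y
  ... | yes _ = s≤s z≤n
  position-< {x} {y ∷ ys} (here x≡y)  | no x≢y = contradiction x≡y x≢y
  position-< {x} {y ∷ ys} (there x∈)  | no _   = s≤s (position-< x∈)

  lookupOr-position : ∀ d {x ys} → x ∈ ys → lookupOr d ys (position x ys) ≡ x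
  lookupOr-position d {x} {y ∷ ys} x∈ with x ≟ y
  ... | yes x≡y = sym x≡y
  lookupOr-position d {x} {y ∷ ys} (here x≡y) | no x≢y = contradiction x≡y x≢y
  lookupOr-position d {x} {y ∷ ys} (there x∈) | no _   = lookupOr-position d x∈

  position-injective : ∀ {x x′ ys} → x ∈ ys → x′ ∈ ys → position x ys ≡ position x′ ys → x ≡ x′
  position-injective {x} {x′} {ys} x∈ x′∈ eq = begin
    x                                ≡⟨ sym (lookupOr-position x x∈) ⟩
    lookupOr x ys (position x ys)    ≡⟨ cong (lookupOr x ys) eq ⟩
    lookupOr x ys (position x′ ys)   ≡⟨ lookupOr-position x x′∈ ⟩
    x′                               ∎
    where open ≡-Reasoning

  position-lookupOr : ∀ d {ys} i → Unique ys → i < length ys → position (lookupOr d ys i) ys ≡ i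
  position-lookupOr d {y ∷ ys} zero _ _ with y ≟ y
  ... | yes _   = refl
  ... | no y≢y  = contradiction refl y≢y
  position-lookupOr d {y ∷ ys} (suc i) (y∉ys ∷ ys!) (s≤s i<) with lookupOr d ys i ≟ y
  ... | yes eq = contradiction (sym eq) (All.lookup y∉ys (lookupOr-∈ d i i<))
  ... | no _   = cong suc (position-lookupOr d i ys! i<)

-- Sorted degree sequences

-- The function computing mT in Defs, which is private there.
mFrom : ℕ → List ℕ → ℕ
mFrom j [] = 0
mFrom j (d ∷ ds) = (if j ≤ᵇ d then suc j else 0) ⊔ mFrom (suc j) ds

-- 0 past the end of the list
nth : List ℕ → ℕ → ℕ
nth [] _ = 0
nth (d ∷ _) zero = d
nth (_ ∷ ds) (suc i) = nth ds i

NonIncreasing : List ℕ → Set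
NonIncreasing = AllPairs (λ d d′ → d′ ≤ d)

count : ℕ → List ℕ → ℕ
count t ds = length (filter (t ≤?_) ds)

≤-⊔⁻ : ∀ {k a b} → k ≤ a ⊔ b → k ≤ a ⊎ k ≤ b
≤-⊔⁻ {k} {a} {b} k≤ with ≤-total a b
... | inj₁ a≤b = inj₂ (subst (k ≤_) (m≤n⇒m⊔n≡n a≤b) k≤)
... | inj₂ b≤a = inj₁ (subst (k ≤_) (m≥n⇒m⊔n≡m b≤a) k≤)

mFrom-≥ : ∀ j ds i → i < length ds → j + i ≤ nth ds i → suc (j + i) ≤ mFrom j ds
mFrom-≥ j (d ∷ ds) zero _ j+0≤d with j ≤ᵇ d | ≤ᵇ-reflects-≤ j d
... | true  | _       = subst (λ m → suc m ≤ suc j ⊔ mFrom (suc j) ds) (sym (+-identityʳ j)) (m≤m⊔n (suc j) (mFrom (suc j) ds))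
... | false | ofⁿ j≰d = contradiction (subst (_≤ d) (+-identityʳ j) j+0≤d) j≰d
mFrom-≥ j (d ∷ ds) (suc i) (s≤s i<) j+i≤ rewrite +-suc j i =
  m≤n⇒m≤o⊔n (if j ≤ᵇ d then suc j else 0) (mFrom-≥ (suc j) ds i i< j+i≤)

mFrom-≤ : ∀ j ds k → 0 < k → k ≤ mFrom j ds → ∃[ i ] i < length ds × k ≤ suc (j + i) × j + i ≤ nth ds i
mFrom-≤ j [] k 0<k k≤ = contradiction (<-≤-trans 0<k k≤) λ ()
mFrom-≤ j (d ∷ ds) k 0<k k≤ with j ≤ᵇ d | ≤ᵇ-reflects-≤ j d | ≤-⊔⁻ {k} {if j ≤ᵇ d then suc j else 0} k≤
... | _ | _ | inj₂ k≤rest with i , i< , k≤′ , j+i≤ ← mFrom-≤ (suc j) ds k 0<k k≤rest rewrite sym (+-suc j i) =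
  suc i , s≤s i< , k≤′ , j+i≤
... | true  | ofʸ j≤d | inj₁ k≤j+1 =
  zero , s≤s z≤n , subst (λ m → k ≤ suc m) j≡j+0 k≤j+1 , subst (_≤ d) j≡j+0 j≤d
  where
  j≡j+0 : j ≡ j + 0
  j≡j+0 = sym (+-identityʳ j)
... | false | _       | inj₁ k≤0   = contradiction (<-≤-trans 0<k k≤0) λ ()

All-nth : ∀ {P : ℕ → Set} {ds} → All P ds → ∀ i → i < length ds → P (nth ds i)
All-nth (p ∷ _) zero _ = p
All-nth (_ ∷ ps) (suc i) (s≤s i<) = All-nth ps i i<

count≡0 : ∀ {d t} ds → All (_≤ d) ds → d < t → count t ds ≡ 0
count≡0 [] _ _ = refl
count≡0 {d} {t} (d′ ∷ ds) (d′≤d ∷ ds≤d) d<t with t ≤ᵇ d′ | ≤ᵇ-reflects-≤ t d′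
... | true  | ofʸ t≤d′ = contradiction (≤-trans (<-≤-trans d<t t≤d′) d′≤d) (<-irrefl refl)
... | false | _        = count≡0 ds ds≤d d<t

count-≥ : ∀ {ds} t i → NonIncreasing ds → i < length ds → t ≤ nth ds i → suc i ≤ count t ds
count-≥ {d ∷ ds} t i (ds≤d ∷ ds↓) i< t≤ with t ≤ᵇ d | ≤ᵇ-reflects-≤ t d
count-≥ {d ∷ ds} t zero    (ds≤d ∷ ds↓) _        t≤ | true | _ = s≤s z≤n
count-≥ {d ∷ ds} t (suc i) (ds≤d ∷ ds↓) (s≤s i<) t≤ | true | _ = s≤s (count-≥ t i ds↓ i< t≤)
count-≥ {d ∷ ds} t zero    (ds≤d ∷ ds↓) _        t≤ | false | ofⁿ t≰d = contradiction t≤ t≰d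
count-≥ {d ∷ ds} t (suc i) (ds≤d ∷ ds↓) (s≤s i<) t≤ | false | ofⁿ t≰d = contradiction (≤-trans t≤ (All-nth ds≤d i i<)) t≰d

≤-nth : ∀ {ds} t i → NonIncreasing ds → i < count t ds → t ≤ nth ds i
≤-nth {d ∷ ds} t i (ds≤d ∷ ds↓) i< with t ≤ᵇ d | ≤ᵇ-reflects-≤ t d
≤-nth {d ∷ ds} t zero    (ds≤d ∷ ds↓) _        | true | ofʸ t≤d = t≤d
≤-nth {d ∷ ds} t (suc i) (ds≤d ∷ ds↓) (s≤s i<) | true | _       = ≤-nth t i ds↓ i<
... | false | ofⁿ t≰d = contradiction (subst (i <_) (count≡0 ds ds≤d (≰⇒> t≰d)) i<) λ ()

-- On a non-increasing list, mFrom 0 is the largest k with at least k entries ≥ k - 1.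
suc≤mFrom⇔suc≤count : ∀ {ds} k → NonIncreasing ds → suc k ≤ mFrom 0 ds ⇔ suc k ≤ count k ds
suc≤mFrom⇔suc≤count {ds} k ds↓ = mk⇔ to from
  where
  to : suc k ≤ mFrom 0 ds → suc k ≤ count k ds
  to k<m with i , i< , s≤s k≤i , i≤ ← mFrom-≤ 0 ds (suc k) (s≤s z≤n) k<m =
    ≤-trans (s≤s k≤i) (count-≥ k i ds↓ i< (≤-trans k≤i i≤))
  from : suc k ≤ count k ds → suc k ≤ mFrom 0 ds
  from k<c = mFrom-≥ 0 ds k (<-≤-trans k<c (length-filter (k ≤?_) ds)) (≤-nth k k ds↓ k<c)

NonIncreasing-reverse-sort : ∀ ds → NonIncreasing (reverse (InsertionSort.sort ≤-decTotalOrder ds))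
NonIncreasing-reverse-sort ds =
  AllPairs-reverse⁺ (Linked⇒AllPairs ≤-trans (InsertionSort.sort-↗ ≤-decTotalOrder ds))

count-reverse-sort : ∀ t ds → count t (reverse (InsertionSort.sort ≤-decTotalOrder ds)) ≡ count t ds
count-reverse-sort t ds = ↭-length (filter-↭ (t ≤?_)
  (↭-trans (↭-reverse (InsertionSort.sort ≤-decTotalOrder ds)) (InsertionSort.sort-↭ ≤-decTotalOrder ds)))

count-map : ∀ {A : Set} (f : A → ℕ) t xs → count t (map f xs) ≡ length (filter (λ x → t ≤? f x) xs)
count-map f t [] = refl
count-map f t (x ∷ xs) with t ≤ᵇ f x
... | true  = cong suc (count-map f t xs)
... | false = count-map f t xs

-- Elements, total degrees and the total m-degree

module Elements (G : Graph) where
  open Graph G using (n; adj)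

  Edge-≡ : {e f : Edge G} → proj₁ e ≡ proj₁ f → e ≡ f
  Edge-≡ {_ , u<v , uv} {_ , u<v′ , uv′} refl
    rewrite Fin.<-irrelevant u<v u<v′ | Decidable⇒UIP.≡-irrelevant Bool._≟_ uv uv′ = refl

  -- Defs builds `edges` from a private helper; unification recovers it.
  private
    edgesVia : Σ (Fin n → Fin n → Maybe (Edge G)) λ mk → edges G ≡ concatMap (λ u → mapMaybe (mk u) (allFin n)) (allFin n)
    edgesVia = _ , refl

    mkEdge : Fin n → Fin n → Maybe (Edge G)
    mkEdge = proj₁ edgesVia

    mkEdge-just : ∀ u v e → mkEdge u v ≡ just e → proj₁ e ≡ (u , v)
    mkEdge-just u v e eq with u Fin.<? v | adj u v Bool.≟ true
    mkEdge-just u v e refl | yes _ | yes _ = refl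

    mkEdge-edge : (e : Edge G) → mkEdge (proj₁ (proj₁ e)) (proj₂ (proj₁ e)) ≡ just e
    mkEdge-edge ((u , v) , u<v , uv) with u Fin.<? v | adj u v Bool.≟ true
    ... | yes _   | yes _  = cong just (Edge-≡ refl)
    ... | yes _   | no ¬uv = contradiction uv ¬uv
    ... | no u≮v  | _      = contradiction u<v u≮v

  edges-complete : (e : Edge G) → e ∈ edges G
  edges-complete e@((u , v) , _) =
    ∈-concatMap⁺ (λ u → mapMaybe (mkEdge u) (allFin n)) (Any.map (λ { refl → ∈-mapMaybe⁺ (mkEdge u) (∈-allFin v) (mkEdge-edge e) }) (∈-allFin u))

  edges-unique : Unique (edges G)
  edges-unique = Unique-concatMap⁺ (λ u → mapMaybe (mkEdge u) (allFin n)) same-source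
    (λ u → Unique-mapMaybe⁺ (mkEdge u) (same-target u) (Unique.allFin⁺ n)) (Unique.allFin⁺ n)
    where
    same-source : ∀ {u u′ e} → e ∈ mapMaybe (mkEdge u) (allFin n) → e ∈ mapMaybe (mkEdge u′) (allFin n) → u ≡ u′
    same-source {u} {u′} {e} e∈ e∈′
      with v , _ , eq ← ∈-mapMaybe⁻ (mkEdge u) (allFin n) e∈
         | v′ , _ , eq′ ← ∈-mapMaybe⁻ (mkEdge u′) (allFin n) e∈′
      = trans (sym (cong proj₁ (mkEdge-just u v e eq))) (cong proj₁ (mkEdge-just u′ v′ e eq′))
    same-target : ∀ u {v v′ e} → mkEdge u v ≡ just e → mkEdge u v′ ≡ just e → v ≡ v′
    same-target u {v} {v′} {e} eq eq′ = trans (sym (cong proj₂ (mkEdge-just u v e eq))) (cong proj₂ (mkEdge-just u v′ e eq′))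

  elements-complete : (x : Element G) → x ∈ elements G
  elements-complete (inj₁ v) = ∈-++⁺ˡ (∈-map⁺ inj₁ (∈-allFin v))
  elements-complete (inj₂ e) = ∈-++⁺ʳ (map inj₁ (allFin n)) (∈-map⁺ inj₂ (edges-complete e))

  elements-unique : Unique (elements G)
  elements-unique = Unique.++⁺ (Unique.map⁺ inj₁-injective (Unique.allFin⁺ n)) (Unique.map⁺ inj₂-injective edges-unique) disjoint
    where
    disjoint : ∀ {x} → ¬ (x ∈ map inj₁ (allFin n) × x ∈ map inj₂ (edges G))
    disjoint (v∈ , e∈) with _ , _ , refl ← ∈-map⁻ inj₁ v∈ with _ , _ , () ← ∈-map⁻ inj₂ e∈

  deg-≥ : ∀ v {ws} → Unique ws → (∀ {w} → w ∈ ws → adj v w ≡ true) → length ws ≤ deg G v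
  deg-≥ v = length-filterᵇ-≥ (adj v) ∈-allFin

  deg-≤ : ∀ v {L} → (∀ {w} → adj v w ≡ true → w ∈ L) → deg G v ≤ length L
  deg-≤ v = length-filterᵇ-≤ (adj v) (Unique.allFin⁺ n)

  degT-≥ : ∀ x {zs} → Unique zs → (∀ {z} → z ∈ zs → adjElem G x z ≡ true) → length zs ≤ degT G x
  degT-≥ x = length-filterᵇ-≥ (adjElem G x) elements-complete

  degT-≤ : ∀ x {L} → (∀ {z} → adjElem G x z ≡ true → z ∈ L) → degT G x ≤ length L
  degT-≤ x = length-filterᵇ-≤ (adjElem G x) elements-unique

module MDegree (G : Graph) where
  open Elements G

  -- As for `edges`, the function computing mT is private to Defs: abstracting its arguments lets unification name it.
  private
    mTVia : Σ (ℕ → List ℕ → ℕ) λ go → mT G ≡ go 0 (sortedDegT G)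
    mTVia = go , mT≡go
      where
      go : ℕ → List ℕ → ℕ
      go = _
      mT≡go : mT G ≡ go 0 (sortedDegT G)
      mT≡go with 0 | sortedDegT G
      ... | j | ds = refl

    go≗mFrom : ∀ j ds → proj₁ mTVia j ds ≡ mFrom j ds
    go≗mFrom j [] = refl
    go≗mFrom j (d ∷ ds) = cong ((if j ≤ᵇ d then suc j else 0) ⊔_) (go≗mFrom (suc j) ds)

  mT≡mFrom : mT G ≡ mFrom 0 (sortedDegT G)
  mT≡mFrom = trans (proj₂ mTVia) (go≗mFrom 0 (sortedDegT G))

  atLeast : ℕ → List (Element G)
  atLeast k = filter (λ x → k ≤? degT G x) (elements G)

  count-sortedDegT : ∀ k → count k (sortedDegT G) ≡ length (atLeast k)
  count-sortedDegT k = trans (count-reverse-sort k (map (degT G) (elements G))) (count-map (degT G) k (elements G))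

  suc≤mT⇔ : ∀ k → suc k ≤ mT G ⇔ suc k ≤ length (atLeast k)
  suc≤mT⇔ k rewrite mT≡mFrom | sym (count-sortedDegT k) =
    suc≤mFrom⇔suc≤count k (NonIncreasing-reverse-sort (map (degT G) (elements G)))

  mT-≥ : ∀ k {zs} → Unique zs → k ≤ length zs → (∀ {z} → z ∈ zs → k ≤ suc (degT G z)) → k ≤ mT G
  mT-≥ zero _ _ _ = z≤n
  mT-≥ (suc k) {zs} zs! k<zs k≤degT = Equivalence.from (suc≤mT⇔ k) (≤-trans k<zs zs≤atLeast)
    where
    zs≤atLeast : length zs ≤ length (atLeast k)
    zs≤atLeast = Unique-⊆⇒length≤ zs! (λ z∈ → ∈-filter⁺ (λ x → k ≤? degT G x) (elements-complete _) (≤-pred (k≤degT z∈)))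

  mT-≤ : ∀ m {L} → length L ≤ m → (∀ {x} → m ≤ degT G x → x ∈ L) → mT G ≤ m
  mT-≤ m {L} L≤m big⊆L = ≮⇒≥ λ m<mT → <-irrefl refl (<-≤-trans (Equivalence.to (suc≤mT⇔ m) m<mT) (≤-trans atLeast≤L L≤m))
    where
    atLeast≤L : length (atLeast m) ≤ length L
    atLeast≤L = Unique-⊆⇒length≤ (Unique.filter⁺ (λ x → m ≤? degT G x) elements-unique)
                  (λ x∈ → big⊆L (proj₂ (∈-filter⁻ (λ x → m ≤? degT G x) {xs = elements G} x∈)))

  bChromatic⇒≤suc-degT : ∀ {k} (c : Element G → Fin k) x → IsTotalBChromaticElem G k c x → k ≤ suc (degT G x)
  bChromatic⇒≤suc-degT {k} c x x-b = subst (_≤ suc (degT G x)) (trans (length-map pick (allFin k)) (length-tabulate id))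
    (Unique-⊆⇒length≤ (Unique.map⁺ pick-injective (Unique.allFin⁺ k)) picks⊆)
    where
    pick : Fin k → Element G
    pick j with j Fin.≟ c x
    ... | yes _   = x
    ... | no j≢cx = proj₁ (Equivalence.to (x-b j) j≢cx)
    c∘pick : ∀ j → c (pick j) ≡ j
    c∘pick j with j Fin.≟ c x
    ... | yes j≡cx = sym j≡cx
    ... | no j≢cx  = proj₂ (proj₂ (Equivalence.to (x-b j) j≢cx))
    pick-injective : ∀ {i j} → pick i ≡ pick j → i ≡ j
    pick-injective {i} {j} eq = trans (sym (c∘pick i)) (trans (cong c eq) (c∘pick j))
    pick∈ : ∀ j → pick j ∈ x ∷ filterᵇ (adjElem G x) (elements G)
    pick∈ j with j Fin.≟ c x
    ... | yes _   = here refl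
    ... | no j≢cx = there (∈-filterᵇ⁺ (adjElem G x) (elements-complete _) (proj₁ (proj₂ (Equivalence.to (x-b j) j≢cx))))
    picks⊆ : ∀ {z} → z ∈ map pick (allFin k) → z ∈ x ∷ filterᵇ (adjElem G x) (elements G)
    picks⊆ z∈ with j , _ , refl ← ∈-map⁻ pick z∈ = pick∈ j

  φt≤mT : ∀ k → HasTotalBChromaticColouring G k → k ≤ mT G
  φt≤mT k (c , _ , b-elements) = mT-≥ k (Unique.map⁺ b-injective (Unique.allFin⁺ k)) (≤-reflexive (sym length-bs)) b-degT
    where
    b : Fin k → Element G
    b j = proj₁ (b-elements j)
    b-injective : ∀ {i j} → b i ≡ b j → i ≡ j
    b-injective {i} {j} eq = trans (sym (proj₁ (proj₂ (b-elements i)))) (trans (cong c eq) (proj₁ (proj₂ (b-elements j))))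
    length-bs : length (map b (allFin k)) ≡ k
    length-bs = trans (length-map b (allFin k)) (length-tabulate id)
    b-degT : ∀ {z} → z ∈ map b (allFin k) → k ≤ suc (degT G z)
    b-degT z∈ with j , _ , refl ← ∈-map⁻ b z∈ = bChromatic⇒≤suc-degT c (b j) (proj₂ (proj₂ (b-elements j)))

module Adjacency (G : Graph) where
  open Graph G using (n; adj) renaming (sym to adj-comm; irrefl to adj-irrefl)
  open Elements G
  open MDegree G

  Adj-sym : ∀ {u v} → adj u v ≡ true → adj v u ≡ true
  Adj-sym {u} {v} uv = trans (adj-comm v u) uv

  Adj⇒≢ : ∀ {u v} → adj u v ≡ true → u ≢ v
  Adj⇒≢ {u} uv refl with () ← trans (sym uv) (adj-irrefl u)

  neighbours : Fin n → List (Fin n)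
  neighbours v = filterᵇ (adj v) (allFin n)

  neighbours-unique : ∀ v → Unique (neighbours v)
  neighbours-unique v = Unique-filterᵇ⁺ (adj v) (Unique.allFin⁺ n)

  ∈-neighbours⁺ : ∀ {v w} → adj v w ≡ true → w ∈ neighbours v
  ∈-neighbours⁺ {v} {w} vw = ∈-filterᵇ⁺ (adj v) (∈-allFin w) vw

  ∈-neighbours⁻ : ∀ {v w} → w ∈ neighbours v → adj v w ≡ true
  ∈-neighbours⁻ {v} w∈ = proj₂ (∈-filterᵇ⁻ (adj v) (allFin n) w∈)

  _∈ₑ_ : Fin n → Edge G → Set
  w ∈ₑ ((a , b) , _) = w ≡ a ⊎ w ≡ b

  -- This covers adjElem G (inj₂ e) (inj₁ w) too, which is the same Boolean.
  adjElem-vertex-edge : ∀ w e → adjElem G (inj₁ w) (inj₂ e) ≡ true ⇔ w ∈ₑ e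
  adjElem-vertex-edge w e@((a , b) , _) = mk⇔ to from
    where
    to : adjElem G (inj₁ w) (inj₂ e) ≡ true → w ≡ a ⊎ w ≡ b
    to h with w Fin.≟ a | w Fin.≟ b
    ... | yes w≡a | _       = inj₁ w≡a
    ... | no _    | yes w≡b = inj₂ w≡b
    to () | no _ | no _
    from : w ≡ a ⊎ w ≡ b → adjElem G (inj₁ w) (inj₂ e) ≡ true
    from w∈ with w Fin.≟ a | w Fin.≟ b
    ... | yes _   | _     = refl
    ... | no _    | yes _ = refl
    ... | no w≢a  | no w≢b = contradiction w∈ [ w≢a , w≢b ]′

  adjElem-edge-edge : ∀ e f → adjElem G (inj₂ e) (inj₂ f) ≡ true ⇔ (e ≢ f × ∃[ w ] w ∈ₑ e × w ∈ₑ f)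
  adjElem-edge-edge e@((a , b) , _) f@((c , d) , _) = mk⇔ to from
    where
    to : adjElem G (inj₂ e) (inj₂ f) ≡ true → e ≢ f × ∃[ w ] w ∈ₑ e × w ∈ₑ f
    to h with a Fin.≟ c | a Fin.≟ d | b Fin.≟ c | b Fin.≟ d
    to () | yes refl | _ | _ | yes refl
    ... | yes a≡c | _       | _       | no b≢d = (λ { refl → b≢d refl }) , a , inj₁ refl , inj₁ a≡c
    ... | no a≢c  | yes a≡d | _       | _      = (λ { refl → a≢c refl }) , a , inj₁ refl , inj₂ a≡d
    ... | no a≢c  | no _    | yes b≡c | _      = (λ { refl → a≢c refl }) , b , inj₂ refl , inj₁ b≡c
    ... | no a≢c  | no _    | no _    | yes b≡d = (λ { refl → a≢c refl }) , b , inj₂ refl , inj₂ b≡d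
    to () | no _ | no _ | no _ | no _
    from : e ≢ f × ∃[ w ] w ∈ₑ e × w ∈ₑ f → adjElem G (inj₂ e) (inj₂ f) ≡ true
    from (e≢f , w , w∈e , w∈f) with a Fin.≟ c | a Fin.≟ d | b Fin.≟ c | b Fin.≟ d
    ... | yes refl | _     | _     | yes refl = contradiction (Edge-≡ refl) e≢f
    ... | yes _    | _     | _     | no _  = refl
    ... | no _     | yes _ | _     | _     = refl
    ... | no _     | no _  | yes _ | _     = refl
    ... | no _     | no _  | no _  | yes _ = refl
    ... | no a≢c   | no a≢d | no b≢c | no b≢d with w∈e | w∈f
    ...   | inj₁ refl | inj₁ refl = contradiction refl a≢c
    ...   | inj₁ refl | inj₂ refl = contradiction refl a≢d
    ...   | inj₂ refl | inj₁ refl = contradiction refl b≢c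
    ...   | inj₂ refl | inj₂ refl = contradiction refl b≢d

  -- The element of the edge uv; a junk value (the vertex u) when u and v are not adjacent.
  edgeOf : Fin n → Fin n → Element G
  edgeOf u v with Fin.<-cmp u v | adj u v Bool.≟ true | adj v u Bool.≟ true
  ... | tri< u<v _ _ | yes uv | _      = inj₂ ((u , v) , u<v , uv)
  ... | tri> _ _ v<u | _      | yes vu = inj₂ ((v , u) , v<u , vu)
  ... | _            | _      | _      = inj₁ u

  edgeOf-≡ : ∀ {u v} → adj u v ≡ true → ∃[ e ] edgeOf u v ≡ inj₂ e × (proj₁ e ≡ (u , v) ⊎ proj₁ e ≡ (v , u))
  edgeOf-≡ {u} {v} uv with Fin.<-cmp u v | adj u v Bool.≟ true | adj v u Bool.≟ true
  ... | tri< _ _ _ | yes _  | _      = _ , refl , inj₁ refl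
  ... | tri< _ _ _ | no ¬uv | _      = contradiction uv ¬uv
  ... | tri≈ _ u≡v _ | _    | _      = contradiction u≡v (Adj⇒≢ uv)
  ... | tri> _ _ _ | _      | yes _  = _ , refl , inj₂ refl
  ... | tri> _ _ _ | _      | no ¬vu = contradiction (Adj-sym uv) ¬vu

  inj₂≡edgeOf : (e : Edge G) → inj₂ e ≡ edgeOf (proj₁ (proj₁ e)) (proj₂ (proj₁ e))
  inj₂≡edgeOf ((u , v) , u<v , uv) with Fin.<-cmp u v | adj u v Bool.≟ true | adj v u Bool.≟ true
  ... | tri< _ _ _   | yes _  | _ = cong inj₂ (Edge-≡ refl)
  ... | tri< _ _ _   | no ¬uv | _ = contradiction uv ¬uv
  ... | tri≈ u≮v _ _ | _      | _ = contradiction u<v u≮v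
  ... | tri> u≮v _ _ | _      | _ = contradiction u<v u≮v

  edgeOf≢vertex : ∀ {u v w} → adj u v ≡ true → edgeOf u v ≢ inj₁ w
  edgeOf≢vertex uv eq with _ , eq′ , _ ← edgeOf-≡ uv with () ← trans (sym eq′) eq

  edgeOf-endpoints : ∀ {u v a b} → adj u v ≡ true → adj a b ≡ true → edgeOf u v ≡ edgeOf a b →
                     (u ≡ a × v ≡ b) ⊎ (u ≡ b × v ≡ a)
  edgeOf-endpoints uv ab eq with edgeOf-≡ uv | edgeOf-≡ ab
  ... | e , eq₁ , ends₁ | f , eq₂ , ends₂ with refl ← inj₂-injective (trans (sym eq₁) (trans eq eq₂)) = same-pair ends₁ ends₂
    where
    same-pair : ∀ {p : Fin n × Fin n} {u v a b} → p ≡ (u , v) ⊎ p ≡ (v , u) → p ≡ (a , b) ⊎ p ≡ (b , a) →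
                (u ≡ a × v ≡ b) ⊎ (u ≡ b × v ≡ a)
    same-pair (inj₁ refl) (inj₁ refl) = inj₁ (refl , refl)
    same-pair (inj₁ refl) (inj₂ refl) = inj₂ (refl , refl)
    same-pair (inj₂ refl) (inj₁ refl) = inj₂ (refl , refl)
    same-pair (inj₂ refl) (inj₂ refl) = inj₁ (refl , refl)

  edgeOf-comm : ∀ {u v} → adj u v ≡ true → edgeOf u v ≡ edgeOf v u
  edgeOf-comm uv with e , eq₁ , ends₁ ← edgeOf-≡ uv | f , eq₂ , ends₂ ← edgeOf-≡ (Adj-sym uv) =
    trans eq₁ (trans (cong inj₂ (Edge-≡ (same-ends e f ends₁ ends₂))) (sym eq₂))
    where
    same-ends : ∀ {u v} (e f : Edge G) → proj₁ e ≡ (u , v) ⊎ proj₁ e ≡ (v , u) → proj₁ f ≡ (v , u) ⊎ proj₁ f ≡ (u , v) → proj₁ e ≡ proj₁ f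
    same-ends _ _ (inj₁ e≡) (inj₂ f≡) = trans e≡ (sym f≡)
    same-ends _ _ (inj₂ e≡) (inj₁ f≡) = trans e≡ (sym f≡)
    same-ends (_ , u<v , _) (_ , v<u , _) (inj₁ refl) (inj₁ refl) = contradiction u<v (Fin.<-asym v<u)
    same-ends (_ , v<u , _) (_ , u<v , _) (inj₂ refl) (inj₂ refl) = contradiction u<v (Fin.<-asym v<u)

  edgeOf-injective : ∀ {v a b} → adj v a ≡ true → adj v b ≡ true → edgeOf v a ≡ edgeOf v b → a ≡ b
  edgeOf-injective va vb eq with edgeOf-endpoints va vb eq
  ... | inj₁ (_ , a≡b)    = a≡b
  ... | inj₂ (v≡b , a≡v)  = contradiction (sym a≡v) (Adj⇒≢ va)

  ∈ₑ⇒edgeOf : ∀ {w} (e : Edge G) → w ∈ₑ e → ∃[ v ] adj w v ≡ true × inj₂ e ≡ edgeOf w v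
  ∈ₑ⇒edgeOf e@((a , b) , _ , ab) (inj₁ refl) = b , ab , inj₂≡edgeOf e
  ∈ₑ⇒edgeOf e@((a , b) , _ , ab) (inj₂ refl) = a , Adj-sym ab , trans (inj₂≡edgeOf e) (edgeOf-comm ab)

  infix 4 _~_

  -- Adjacency of elements, with every edge written as edgeOf of its endpoints and the shared vertex first.
  data _~_ : Element G → Element G → Set where
    vertex~vertex : ∀ {u v} → adj u v ≡ true → inj₁ u ~ inj₁ v
    vertex~edge   : ∀ {u v} → adj u v ≡ true → inj₁ u ~ edgeOf u v
    edge~vertex   : ∀ {u v} → adj u v ≡ true → edgeOf u v ~ inj₁ u
    edge~edge     : ∀ {u v w} → adj u v ≡ true → adj u w ≡ true → v ≢ w → edgeOf u v ~ edgeOf u w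

  ∈ₑ-edgeOf : ∀ {u v} → adj u v ≡ true → ∃[ e ] edgeOf u v ≡ inj₂ e × u ∈ₑ e
  ∈ₑ-edgeOf uv with edgeOf-≡ uv
  ... | e , eq , inj₁ refl = e , eq , inj₁ refl
  ... | e , eq , inj₂ refl = e , eq , inj₂ refl

  ~⇒adjElem : ∀ {x y} → x ~ y → adjElem G x y ≡ true
  ~⇒adjElem (vertex~vertex uv) = uv
  ~⇒adjElem (vertex~edge uv) with e , eq , u∈e ← ∈ₑ-edgeOf uv rewrite eq =
    Equivalence.from (adjElem-vertex-edge _ e) u∈e
  ~⇒adjElem (edge~vertex uv) with e , eq , u∈e ← ∈ₑ-edgeOf uv rewrite eq =
    Equivalence.from (adjElem-vertex-edge _ e) u∈e
  ~⇒adjElem (edge~edge uv uw v≢w) with e , eq₁ , u∈e ← ∈ₑ-edgeOf uv | f , eq₂ , u∈f ← ∈ₑ-edgeOf uw rewrite eq₁ | eq₂ =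
    Equivalence.from (adjElem-edge-edge e f) ((λ { refl → v≢w (edgeOf-injective uv uw (trans eq₁ (sym eq₂))) }) , _ , u∈e , u∈f)

  adjElem⇒~ : ∀ x y → adjElem G x y ≡ true → x ~ y
  adjElem⇒~ (inj₁ u) (inj₁ v) uv = vertex~vertex uv
  adjElem⇒~ (inj₁ w) (inj₂ e) h with v , wv , e≡ ← ∈ₑ⇒edgeOf e (Equivalence.to (adjElem-vertex-edge w e) h) =
    subst (inj₁ w ~_) (sym e≡) (vertex~edge wv)
  adjElem⇒~ (inj₂ e) (inj₁ w) h with v , wv , e≡ ← ∈ₑ⇒edgeOf e (Equivalence.to (adjElem-vertex-edge w e) h) =
    subst (_~ inj₁ w) (sym e≡) (edge~vertex wv)
  adjElem⇒~ (inj₂ e) (inj₂ f) h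
    with e≢f , w , w∈e , w∈f ← Equivalence.to (adjElem-edge-edge e f) h
    with v , wv , e≡ ← ∈ₑ⇒edgeOf e w∈e | v′ , wv′ , f≡ ← ∈ₑ⇒edgeOf f w∈f =
    subst₂ _~_ (sym e≡) (sym f≡) (edge~edge wv wv′ λ { refl → e≢f (inj₂-injective (trans e≡ (sym f≡))) })

  ~-sym : ∀ {x y} → x ~ y → y ~ x
  ~-sym (vertex~vertex uv)      = vertex~vertex (Adj-sym uv)
  ~-sym (vertex~edge uv)        = edge~vertex uv
  ~-sym (edge~vertex uv)        = vertex~edge uv
  ~-sym (edge~edge uv uw v≢w)   = edge~edge uw uv (v≢w ∘ sym)

  vertex~edge′ : ∀ {u v} → adj u v ≡ true → inj₁ v ~ edgeOf u v
  vertex~edge′ uv = subst (inj₁ _ ~_) (sym (edgeOf-comm uv)) (vertex~edge (Adj-sym uv))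

  edge~vertex′ : ∀ {u v} → adj u v ≡ true → edgeOf u v ~ inj₁ v
  edge~vertex′ = ~-sym ∘ vertex~edge′

  edge~edge-path : ∀ {u v w} → adj u v ≡ true → adj v w ≡ true → u ≢ w → edgeOf u v ~ edgeOf v w
  edge~edge-path uv vw u≢w = subst (_~ edgeOf _ _) (sym (edgeOf-comm uv)) (edge~edge (Adj-sym uv) vw u≢w)

  deg≤degT-vertex : ∀ v → deg G v ≤ degT G (inj₁ v)
  deg≤degT-vertex v = subst (_≤ degT G (inj₁ v)) (length-map inj₁ (neighbours v))
    (degT-≥ (inj₁ v) (Unique.map⁺ inj₁-injective (neighbours-unique v)) adjacent)
    where
    adjacent : ∀ {z} → z ∈ map inj₁ (neighbours v) → adjElem G (inj₁ v) z ≡ true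
    adjacent z∈ with w , w∈ , refl ← ∈-map⁻ inj₁ z∈ = ∈-neighbours⁻ w∈

  -- For w adjacent to u: the edge uw, except that for w = v it is the vertex u. These are neighbours of the edge uv.
  atEdge : Fin n → Fin n → Fin n → Element G
  atEdge u v w with w Fin.≟ v
  ... | yes _ = inj₁ u
  ... | no _  = edgeOf u w

  atEdge-self : ∀ u v → atEdge u v v ≡ inj₁ u
  atEdge-self u v with v Fin.≟ v
  ... | yes _  = refl
  ... | no v≢v = contradiction refl v≢v

  atEdge-other : ∀ u {v w} → w ≢ v → atEdge u v w ≡ edgeOf u w
  atEdge-other u {v} {w} w≢v with w Fin.≟ v
  ... | yes w≡v = contradiction w≡v w≢v
  ... | no _    = refl

  deg≤degT-edge : ∀ {u v} → adj u v ≡ true → deg G u ≤ degT G (edgeOf u v)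
  deg≤degT-edge {u} {v} uv = subst (_≤ degT G (edgeOf u v)) (length-map (atEdge u v) (neighbours u))
    (degT-≥ (edgeOf u v) (Unique-map-on⁺ (atEdge u v) injective (neighbours-unique u)) adjacent)
    where
    injective : ∀ {w w′} → w ∈ neighbours u → w′ ∈ neighbours u → atEdge u v w ≡ atEdge u v w′ → w ≡ w′
    injective {w} {w′} w∈ w′∈ eq with w Fin.≟ v | w′ Fin.≟ v
    ... | yes w≡v | yes w′≡v = trans w≡v (sym w′≡v)
    ... | yes _   | no _     = contradiction (sym eq) (edgeOf≢vertex (∈-neighbours⁻ w′∈))
    ... | no _    | yes _    = contradiction eq (edgeOf≢vertex (∈-neighbours⁻ w∈))
    ... | no _    | no _     = edgeOf-injective (∈-neighbours⁻ w∈) (∈-neighbours⁻ w′∈) eq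
    adjacent : ∀ {z} → z ∈ map (atEdge u v) (neighbours u) → adjElem G (edgeOf u v) z ≡ true
    adjacent z∈ with w , w∈ , refl ← ∈-map⁻ (atEdge u v) z∈ with w Fin.≟ v
    ... | yes _   = ~⇒adjElem (edge~vertex uv)
    ... | no w≢v  = ~⇒adjElem (edge~edge uv (∈-neighbours⁻ w∈) (w≢v ∘ sym))

  -- A vertex and its incident edges are deg v + 1 elements of total degree at least deg v.
  deg<mT : ∀ v → suc (deg G v) ≤ mT G
  deg<mT v = mT-≥ (suc (deg G v)) zs! (≤-reflexive (cong suc (sym (length-map (edgeOf v) (neighbours v))))) deg≤
    where
    zs! : Unique (inj₁ v ∷ map (edgeOf v) (neighbours v))
    zs! = All.tabulate (λ z∈ eq → vertex∉ z∈ (sym eq)) ∷ Unique-map-on⁺ (edgeOf v)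
            (λ w∈ w′∈ → edgeOf-injective (∈-neighbours⁻ w∈) (∈-neighbours⁻ w′∈)) (neighbours-unique v)
      where
      vertex∉ : ∀ {z} → z ∈ map (edgeOf v) (neighbours v) → z ≢ inj₁ v
      vertex∉ z∈ with w , w∈ , refl ← ∈-map⁻ (edgeOf v) z∈ = edgeOf≢vertex (∈-neighbours⁻ w∈)
    deg≤ : ∀ {z} → z ∈ inj₁ v ∷ map (edgeOf v) (neighbours v) → suc (deg G v) ≤ suc (degT G z)
    deg≤ (here refl) = s≤s (deg≤degT-vertex v)
    deg≤ (there z∈) with w , w∈ , refl ← ∈-map⁻ (edgeOf v) z∈ = s≤s (deg≤degT-edge (∈-neighbours⁻ w∈))

-- Caterpillars

module Caterpillar (G : Graph) (cat : IsCaterpillar G) where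
  open Graph G using (n; adj)
  open Elements G
  open Adjacency G

  connected : Connected G
  connected = proj₁ (proj₁ cat)

  P : List (Fin n)
  P = proj₁ (proj₂ cat)

  P-unique : Unique P
  P-unique = proj₁ (proj₁ (proj₂ (proj₂ cat)))

  P-linked : Linked (Adj G) P
  P-linked = proj₂ (proj₁ (proj₂ (proj₂ cat)))

  s : ℕ
  s = length P

  _∈P? : ∀ v → Dec (v ∈ P)
  v ∈P? = v ∈? P
    where open import Data.List.Membership.DecPropositional (Fin._≟_ {n}) using (_∈?_)

  deg-≥1 : ∀ {v w} → adj v w ≡ true → 1 ≤ deg G v
  deg-≥1 {v} vw = deg-≥ v ([] ∷ []) λ { (here refl) → vw }

  deg-≥2 : ∀ {v w w′} → adj v w ≡ true → adj v w′ ≡ true → w ≢ w′ → 2 ≤ deg G v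
  deg-≥2 {v} vw vw′ w≢w′ = deg-≥ v ((w≢w′ ∷ []) ∷ [] ∷ []) λ { (here refl) → vw ; (there (here refl)) → vw′ }

  ∈P⇒deg≥2 : ∀ {v} → v ∈ P → 2 ≤ deg G v
  ∈P⇒deg≥2 {v} = Equivalence.to (proj₁ (proj₂ (proj₂ (proj₂ cat))) v)

  ∉P⇒deg≤1 : ∀ {v} → v ∉ P → deg G v ≤ 1
  ∉P⇒deg≤1 {v} v∉ = ≤-pred (≰⇒> (v∉ ∘ Equivalence.from (proj₁ (proj₂ (proj₂ (proj₂ cat))) v)))

  ∉P-adj-unique : ∀ {v w w′} → v ∉ P → adj v w ≡ true → adj v w′ ≡ true → w ≡ w′
  ∉P-adj-unique {w = w} {w′} v∉ vw vw′ with w Fin.≟ w′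
  ... | yes w≡w′ = w≡w′
  ... | no w≢w′  = contradiction (≤-trans (deg-≥2 vw vw′ w≢w′) (∉P⇒deg≤1 v∉)) λ { (s≤s ()) }

  -- The unique neighbour of a leaf.
  parent : Fin n → Fin n
  parent v = lookupOr v (neighbours v) 0

  parent-≡ : ∀ {v w} → v ∉ P → adj v w ≡ true → parent v ≡ w
  parent-≡ v∉ vw = ∉P-adj-unique v∉ (∈-neighbours⁻ (lookupOr-∈ _ 0 (deg-≥1 vw))) vw

  v₀ : Fin n
  v₀ = Fin.fromℕ< (proj₁ connected)

  -- The i-th vertex of P (v₀ past its end).
  p : ℕ → Fin n
  p = lookupOr v₀ P

  index : Fin n → ℕ
  index v = position Fin._≟_ v P

  p∈P : ∀ {i} → i < s → p i ∈ P
  p∈P {i} = lookupOr-∈ v₀ i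

  p-index : ∀ {v} → v ∈ P → p (index v) ≡ v
  p-index = lookupOr-position Fin._≟_ v₀

  index-p : ∀ {i} → i < s → index (p i) ≡ i
  index-p {i} = position-lookupOr Fin._≟_ v₀ i P-unique

  index-< : ∀ {v} → v ∈ P → index v < s
  index-< = position-< Fin._≟_

  ∈P⇒≡p : ∀ {v} → v ∈ P → ∃[ i ] i < s × v ≡ p i
  ∈P⇒≡p v∈ = index _ , index-< v∈ , sym (p-index v∈)

  p-injective : ∀ {i j} → i < s → j < s → p i ≡ p j → i ≡ j
  p-injective {i} {j} i< j< eq = trans (sym (index-p i<)) (trans (cong index eq) (index-p j<))

  p-adj : ∀ {i} → suc i < s → adj (p i) (p (suc i)) ≡ true
  p-adj {i} = go i P-linked
    where
    go : ∀ {xs} i → Linked (Adj G) xs → suc i < length xs → adj (lookupOr v₀ xs i) (lookupOr v₀ xs (suc i)) ≡ true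
    go zero    (xy ∷ _)  _          = xy
    go (suc i) (_ ∷ xs~) (s≤s i<)   = go i xs~ i<
    go _       [-]       (s≤s ())

  -- In a path q ∷ Q, a vertex of Q adjacent to q is the head of Q: otherwise q and the part of Q up to it form a cycle.
  adj-head : ∀ {q x Q} → Unique (q ∷ Q) → Linked (Adj G) (q ∷ Q) → x ∈ Q → adj q x ≡ true → position Fin._≟_ x Q ≡ 0
  adj-head {x = x} {y ∷ Q} _ _ (here refl) _ with x Fin.≟ x
  ... | yes _ = refl
  ... | no x≢x = contradiction refl x≢x
  adj-head {q} {x} {y ∷ Q} (q∉ ∷ Q!) Q~ (there x∈) qx = contradiction cycle (proj₂ (proj₁ cat) (q ∷ upTo (there x∈)))
    where
    upTo : ∀ {Q : List (Fin n)} → x ∈ Q → List (Fin n)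
    upTo {y ∷ _} (here _) = y ∷ []
    upTo {y ∷ _} (there x∈) = y ∷ upTo x∈
    upTo-⊆ : ∀ {Q z} (x∈ : x ∈ Q) → z ∈ upTo x∈ → z ∈ Q
    upTo-⊆ (here _) (here refl) = here refl
    upTo-⊆ (there _) (here refl) = here refl
    upTo-⊆ (there x∈) (there z∈) = there (upTo-⊆ x∈ z∈)
    upTo-unique : ∀ {Q} (x∈ : x ∈ Q) → Unique Q → Unique (upTo x∈)
    upTo-unique (here _) _ = [] ∷ []
    upTo-unique (there x∈) (y∉ ∷ Q!) = All.tabulate (All.lookup y∉ ∘ upTo-⊆ x∈) ∷ upTo-unique x∈ Q!
    upTo-linked : ∀ {q Q} (x∈ : x ∈ Q) → Linked (Adj G) (q ∷ Q) → Linked (Adj G) (q ∷ upTo x∈)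
    upTo-linked (here _) (qy ∷ _) = qy ∷ [-]
    upTo-linked (there x∈) (qy ∷ Q~) = qy ∷ upTo-linked x∈ Q~
    last-upTo : ∀ {Q} a (x∈ : x ∈ Q) → lastOr G a (upTo x∈) ≡ x
    last-upTo a (here refl) = refl
    last-upTo a (there x∈) = last-upTo _ x∈
    1≤length-upTo : ∀ {Q} (x∈ : x ∈ Q) → 1 ≤ length (upTo x∈)
    1≤length-upTo (here _) = s≤s z≤n
    1≤length-upTo (there _) = s≤s z≤n
    cycle : IsCycle G (q ∷ upTo (there x∈))
    cycle = ((All.tabulate (All.lookup q∉ ∘ upTo-⊆ (there x∈)) ∷ upTo-unique (there x∈) Q!) , upTo-linked (there x∈) Q~) ,
            s≤s (1≤length-upTo x∈) , subst (λ z → adj z q ≡ true) (sym (last-upTo q (there x∈))) (Adj-sym qx)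

  index-adj : ∀ {u v} → u ∈ P → v ∈ P → adj u v ≡ true → index v ≡ suc (index u) ⊎ index u ≡ suc (index v)
  index-adj = go P-unique P-linked
    where
    ∈-tail : ∀ {z q Q} → z ∈ q ∷ Q → z ≢ q → z ∈ Q
    ∈-tail (here z≡q) z≢q = contradiction z≡q z≢q
    ∈-tail (there z∈) _ = z∈
    go : ∀ {Q} → Unique Q → Linked (Adj G) Q → ∀ {u v} → u ∈ Q → v ∈ Q → adj u v ≡ true →
         position Fin._≟_ v Q ≡ suc (position Fin._≟_ u Q) ⊎ position Fin._≟_ u Q ≡ suc (position Fin._≟_ v Q)
    go {q ∷ Q} Q! Q~ {u} {v} u∈ v∈ uv with u Fin.≟ q | v Fin.≟ q
    ... | yes refl | yes refl = contradiction refl (Adj⇒≢ uv)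
    ... | yes refl | no v≢q   = inj₁ (cong suc (adj-head Q! Q~ (∈-tail v∈ v≢q) uv))
    ... | no u≢q   | yes refl = inj₂ (cong suc (adj-head Q! Q~ (∈-tail u∈ u≢q) (Adj-sym uv)))
    ... | no u≢q   | no v≢q   = Sum.map (cong suc) (cong suc) (go (AllPairs.tail Q!) (Linked.tail Q~) (∈-tail u∈ u≢q) (∈-tail v∈ v≢q) uv)

  spine-neighbour : ∀ {i q} → i < s → q ∈ P → adj (p i) q ≡ true → (suc i < s × q ≡ p (suc i)) ⊎ ∃[ j ] i ≡ suc j × q ≡ p j
  spine-neighbour {i} {q} i< q∈ pq with index-adj (p∈P i<) q∈ pq
  ... | inj₁ q≡ rewrite index-p i< = inj₁ (subst (_< s) q≡ (index-< q∈) , trans (sym (p-index q∈)) (cong p q≡))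
  ... | inj₂ i≡ rewrite index-p i< = inj₂ (index q , i≡ , sym (p-index q∈))

  leaves : Fin n → List (Fin n)
  leaves v = filter (λ w → ¬? (w ∈P?) ×-dec (adj v w Bool.≟ true)) (allFin n)

  leaves-unique : ∀ v → Unique (leaves v)
  leaves-unique v = Unique.filter⁺ (λ w → ¬? (w ∈P?) ×-dec (adj v w Bool.≟ true)) (Unique.allFin⁺ n)

  ∈-leaves⁺ : ∀ {v w} → w ∉ P → adj v w ≡ true → w ∈ leaves v
  ∈-leaves⁺ {v} {w} w∉ vw = ∈-filter⁺ (λ w → ¬? (w ∈P?) ×-dec (adj v w Bool.≟ true)) (∈-allFin w) (w∉ , vw)

  ∈-leaves⁻ : ∀ {v w} → w ∈ leaves v → w ∉ P × adj v w ≡ true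
  ∈-leaves⁻ {v} = proj₂ ∘ ∈-filter⁻ (λ w → ¬? (w ∈P?) ×-dec (adj v w Bool.≟ true)) {xs = allFin n}

  a : ℕ → ℕ
  a i = length (leaves (p i))

  leaf : ℕ → ℕ → Fin n
  leaf i = lookupOr v₀ (leaves (p i))

  rank : Fin n → ℕ
  rank w = position Fin._≟_ w (leaves (parent w))

  leaf∈ : ∀ {i r} → r < a i → leaf i r ∈ leaves (p i)
  leaf∈ {i} {r} = lookupOr-∈ v₀ r

  leaf∉P : ∀ {i r} → r < a i → leaf i r ∉ P
  leaf∉P = proj₁ ∘ ∈-leaves⁻ ∘ leaf∈

  leaf-adj : ∀ {i r} → r < a i → adj (p i) (leaf i r) ≡ true
  leaf-adj = proj₂ ∘ ∈-leaves⁻ ∘ leaf∈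

  rank-leaf : ∀ {i r} → r < a i → rank (leaf i r) ≡ r
  rank-leaf {i} {r} r< = trans (cong (λ u → position Fin._≟_ (leaf i r) (leaves u)) (parent-≡ (leaf∉P r<) (Adj-sym (leaf-adj r<))))
                                (position-lookupOr Fin._≟_ v₀ r (leaves-unique (p i)) r<)

  leaf-rank : ∀ {i w} → w ∉ P → adj (p i) w ≡ true → rank w < a i × leaf i (rank w) ≡ w
  leaf-rank {i} {w} w∉ pw rewrite parent-≡ w∉ (Adj-sym pw) =
    position-< Fin._≟_ (∈-leaves⁺ w∉ pw) , lookupOr-position Fin._≟_ v₀ (∈-leaves⁺ w∉ pw)

  leaf-injective : ∀ {i r r′} → r < a i → r′ < a i → leaf i r ≡ leaf i r′ → r ≡ r′
  leaf-injective r< r′< eq = trans (sym (rank-leaf r<)) (trans (cong rank eq) (rank-leaf r′<))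

  p≢leaf : ∀ {i j r} → j < s → r < a i → p j ≢ leaf i r
  p≢leaf j< r< eq = leaf∉P r< (subst (_∈ P) eq (p∈P j<))

  rank-ne : ∀ {v w w′} → w ∉ P → w′ ∉ P → adj v w ≡ true → adj v w′ ≡ true → w ≢ w′ → rank w ≢ rank w′
  rank-ne {v} w∉ w′∉ vw vw′ w≢w′ eq = w≢w′ (position-injective Fin._≟_ (∈-leaves⁺ w∉ vw) (∈-leaves⁺ w′∉ vw′)
    (subst₂ (λ u u′ → position Fin._≟_ _ (leaves u) ≡ position Fin._≟_ _ (leaves u′)) (parent-≡ w∉ (Adj-sym vw)) (parent-≡ w′∉ (Adj-sym vw′)) eq))

  deg-p-≥ : ∀ i {qs} → Unique qs → (∀ {q} → q ∈ qs → q ∈ P × adj (p i) q ≡ true) → length qs + a i ≤ deg G (p i)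
  deg-p-≥ i {qs} qs! qs⊆ = subst (_≤ deg G (p i)) (length-++ qs) (deg-≥ (p i) (Unique.++⁺ qs! (leaves-unique (p i)) disjoint) adjacent)
    where
    disjoint : ∀ {w} → ¬ (w ∈ qs × w ∈ leaves (p i))
    disjoint (w∈qs , w∈leaves) = proj₁ (∈-leaves⁻ w∈leaves) (proj₁ (qs⊆ w∈qs))
    adjacent : ∀ {w} → w ∈ qs ++ leaves (p i) → adj (p i) w ≡ true
    adjacent w∈ with ∈-++⁻ qs w∈
    ... | inj₁ w∈qs     = proj₂ (qs⊆ w∈qs)
    ... | inj₂ w∈leaves = proj₂ (∈-leaves⁻ w∈leaves)

  deg-p-≤ : ∀ i qs → (∀ {q} → q ∈ P → adj (p i) q ≡ true → q ∈ qs) → deg G (p i) ≤ length qs + a i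
  deg-p-≤ i qs ⊆qs = subst (deg G (p i) ≤_) (length-++ qs) (deg-≤ (p i) adjacent)
    where
    adjacent : ∀ {w} → adj (p i) w ≡ true → w ∈ qs ++ leaves (p i)
    adjacent {w} pw with w ∈P?
    ... | yes w∈ = ∈-++⁺ˡ (⊆qs w∈ pw)
    ... | no w∉  = ∈-++⁺ʳ qs (∈-leaves⁺ w∉ pw)

  deg-first : 2 ≤ s → deg G (p 0) ≡ suc (a 0)
  deg-first 2≤s = ≤-antisym (deg-p-≤ 0 [ p 1 ] only-p1) (deg-p-≥ 0 ([] ∷ []) λ { (here refl) → p∈P 2≤s , p-adj 2≤s })
    where
    only-p1 : ∀ {q} → q ∈ P → adj (p 0) q ≡ true → q ∈ [ p 1 ]
    only-p1 q∈ pq with spine-neighbour (<-trans (s≤s z≤n) 2≤s) q∈ pq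
    ... | inj₁ (_ , q≡) = here q≡
    ... | inj₂ (_ , () , _)

  deg-last : ∀ i → suc (suc i) ≡ s → deg G (p (suc i)) ≡ suc (a (suc i))
  deg-last i i+2≡s = ≤-antisym (deg-p-≤ (suc i) [ p i ] only-pi)
    (deg-p-≥ (suc i) ([] ∷ []) λ { (here refl) → p∈P i< , Adj-sym (p-adj i+1<) })
    where
    i+1< : suc i < s
    i+1< = subst (suc i <_) i+2≡s (n<1+n (suc i))
    i< : i < s
    i< = <-trans (n<1+n i) i+1<
    only-pi : ∀ {q} → q ∈ P → adj (p (suc i)) q ≡ true → q ∈ [ p i ]
    only-pi q∈ pq with spine-neighbour i+1< q∈ pq
    ... | inj₁ (i+2< , _)   = contradiction (subst (_< s) i+2≡s i+2<) (<-irrefl refl)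
    ... | inj₂ (_ , refl , q≡) = here q≡

  deg-middle : ∀ i → suc (suc i) < s → 2 + a (suc i) ≤ deg G (p (suc i))
  deg-middle i i+2< = deg-p-≥ (suc i) (((λ eq → contradiction (p-injective i< i+2< eq) λ ()) ∷ []) ∷ [] ∷ []) neighbours⊆
    where
    i+1< : suc i < s
    i+1< = <-trans (n<1+n (suc i)) i+2<
    i< : i < s
    i< = <-trans (n<1+n i) i+1<
    neighbours⊆ : ∀ {q} → q ∈ p i ∷ p (suc (suc i)) ∷ [] → q ∈ P × adj (p (suc i)) q ≡ true
    neighbours⊆ (here refl)         = p∈P i< , Adj-sym (p-adj i+1<)
    neighbours⊆ (there (here refl)) = p∈P i+2< , p-adj i+2<

  deg-star : s ≡ 1 → deg G (p 0) ≡ a 0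
  deg-star s≡1 = ≤-antisym (deg-p-≤ 0 [] no-spine-neighbour) (deg-p-≥ 0 [] λ ())
    where
    no-spine-neighbour : ∀ {q} → q ∈ P → adj (p 0) q ≡ true → q ∈ []
    no-spine-neighbour q∈ pq with spine-neighbour (subst (0 <_) (sym s≡1) (s≤s z≤n)) q∈ pq
    ... | inj₁ (1< , _) = contradiction (subst (1 <_) s≡1 1<) (<-irrefl refl)
    ... | inj₂ (_ , () , _)

  1≤a-first : 2 ≤ s → 1 ≤ a 0
  1≤a-first 2≤s = ≤-pred (subst (2 ≤_) (deg-first 2≤s) (∈P⇒deg≥2 (p∈P (<-trans (s≤s z≤n) 2≤s))))

  1≤a-last : ∀ i → suc (suc i) ≡ s → 1 ≤ a (suc i)
  1≤a-last i i+2≡s = ≤-pred (subst (2 ≤_) (deg-last i i+2≡s) (∈P⇒deg≥2 (p∈P (subst (suc i <_) i+2≡s (n<1+n (suc i))))))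

  module _ (m≤5 : mT G ≤ 5) where

    deg≤4 : ∀ v → deg G v ≤ 4
    deg≤4 v = ≤-pred (≤-trans (deg<mT v) m≤5)

    a-first≤3 : 2 ≤ s → a 0 ≤ 3
    a-first≤3 2≤s = ≤-pred (subst (_≤ 4) (deg-first 2≤s) (deg≤4 (p 0)))

    a-last≤3 : ∀ i → suc (suc i) ≡ s → a (suc i) ≤ 3
    a-last≤3 i i+2≡s = ≤-pred (subst (_≤ 4) (deg-last i i+2≡s) (deg≤4 (p (suc i))))

    a-middle≤2 : ∀ i → suc (suc i) < s → a (suc i) ≤ 2
    a-middle≤2 i i+2< = ≤-pred (≤-pred (≤-trans (deg-middle i i+2<) (deg≤4 (p (suc i)))))

  module NonEmpty (P≢[] : 1 ≤ s) where

    ∉P⇒adj∈P : ∀ {v w} → v ∉ P → adj v w ≡ true → w ∈ P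
    ∉P⇒adj∈P {v} v∉ vw with proj₂ (proj₂ (proj₂ (proj₂ cat))) v (≤-antisym (∉P⇒deg≤1 v∉) (deg-≥1 vw))
    ... | inj₁ P≡[] = contradiction (subst (λ Q → 1 ≤ length Q) P≡[] P≢[]) λ ()
    ... | inj₂ (u , u∈ , uv) = subst (_∈ P) (∉P-adj-unique v∉ (Adj-sym uv) vw) u∈

    -- A path from a leaf to p 0 starts with an edge.
    ∉P⇒parent : ∀ {v} → v ∉ P → adj v (parent v) ≡ true
    ∉P⇒parent {v} v∉ with proj₂ connected v (p 0)
    ... | [] , _ , v≡p0 = contradiction (subst (_∈ P) (sym v≡p0) (p∈P P≢[])) v∉
    ... | w ∷ _ , (_ , vw ∷ _) , _ = subst (λ u → adj v u ≡ true) (sym (parent-≡ v∉ vw)) vw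

    index-parent< : ∀ {v} → v ∉ P → index (parent v) < s
    index-parent< v∉ = index-< (∉P⇒adj∈P v∉ (∉P⇒parent v∉))

    rank< : ∀ {v w} → w ∉ P → adj v w ≡ true → v ∈ P → rank w < a (index v)
    rank< {v} {w} w∉ vw v∈ rewrite p-index v∈ | parent-≡ w∉ (Adj-sym vw) = position-< Fin._≟_ (∈-leaves⁺ w∉ vw)

    degT-leaf : ∀ {v} → v ∉ P → degT G (inj₁ v) ≤ 2
    degT-leaf {v} v∉ = degT-≤ (inj₁ v) (λ h → neighbour (adjElem⇒~ _ _ h) refl)
      where
      neighbour : ∀ {x z} → x ~ z → x ≡ inj₁ v → z ∈ inj₁ (parent v) ∷ edgeOf v (parent v) ∷ []
      neighbour (vertex~vertex vw)  refl = here (cong inj₁ (sym (parent-≡ v∉ vw)))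
      neighbour (vertex~edge vw)    refl = there (here (cong (edgeOf v) (sym (parent-≡ v∉ vw))))
      neighbour (edge~vertex uw)    eq   = contradiction eq (edgeOf≢vertex uw)
      neighbour (edge~edge uw _ _)  eq   = contradiction eq (edgeOf≢vertex uw)

    degT-pendant : ∀ {u w} → w ∉ P → adj u w ≡ true → degT G (edgeOf u w) ≤ suc (deg G u)
    degT-pendant {u} {w} w∉ uw = subst (degT G (edgeOf u w) ≤_) (cong suc (length-map (atEdge u w) (neighbours u)))
      (degT-≤ (edgeOf u w) (λ h → neighbour (adjElem⇒~ _ _ h) refl))
      where
      atEdge∈ : ∀ {w′} → adj u w′ ≡ true → atEdge u w w′ ∈ map (atEdge u w) (neighbours u)
      atEdge∈ uw′ = ∈-map⁺ (atEdge u w) (∈-neighbours⁺ uw′)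
      neighbour : ∀ {x z} → x ~ z → x ≡ edgeOf u w → z ∈ inj₁ w ∷ map (atEdge u w) (neighbours u)
      neighbour (vertex~vertex _) eq = contradiction (sym eq) (edgeOf≢vertex uw)
      neighbour (vertex~edge _)   eq = contradiction (sym eq) (edgeOf≢vertex uw)
      neighbour (edge~vertex u′v′) eq with edgeOf-endpoints u′v′ uw eq
      ... | inj₁ (refl , refl) = there (subst (_∈ map (atEdge u w) (neighbours u)) (atEdge-self u w) (atEdge∈ uw))
      ... | inj₂ (refl , refl) = here refl
      neighbour (edge~edge u′v′ u′w′ v′≢w′) eq with edgeOf-endpoints u′v′ uw eq
      ... | inj₁ (refl , refl) = there (subst (_∈ map (atEdge u w) (neighbours u)) (atEdge-other u (v′≢w′ ∘ sym)) (atEdge∈ u′w′))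
      ... | inj₂ (refl , refl) = contradiction (∉P-adj-unique w∉ u′v′ u′w′) v′≢w′

    data Kind (x : Element G) : Set where
      spine-vertex : ∀ {v} → v ∈ P → x ≡ inj₁ v → Kind x
      leaf-vertex  : ∀ {v} → v ∉ P → x ≡ inj₁ v → Kind x
      spine-edge   : ∀ {u v} → u ∈ P → v ∈ P → adj u v ≡ true → x ≡ edgeOf u v → Kind x
      pendant-edge : ∀ {u w} → u ∈ P → w ∉ P → adj u w ≡ true → x ≡ edgeOf u w → Kind x

    kind : ∀ x → Kind x
    kind (inj₁ v) with v ∈P?
    ... | yes v∈ = spine-vertex v∈ refl
    ... | no v∉  = leaf-vertex v∉ refl
    kind (inj₂ e@((u , v) , _ , uv)) with u ∈P? | v ∈P?
    ... | yes u∈ | yes v∈ = spine-edge u∈ v∈ uv (inj₂≡edgeOf e)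
    ... | yes u∈ | no v∉  = pendant-edge u∈ v∉ uv (inj₂≡edgeOf e)
    ... | no u∉  | yes v∈ = pendant-edge v∈ u∉ (Adj-sym uv) (trans (inj₂≡edgeOf e) (edgeOf-comm uv))
    ... | no u∉  | no v∉  = contradiction (∉P⇒adj∈P u∉ uv) v∉

-- The elements of a caterpillar with spine 0, 1, …: spine vertices, spine edges spineE i = {i, i + 1},
-- and the leaves leafV i r at spine vertex i with their pendant edges leafE i r.
data Code : Set where
  spineV spineE : ℕ → Code
  leafV leafE : ℕ → ℕ → Code

-- One orientation of each adjacency between codes.
data Incident : Code → Code → Set where
  vv : ∀ i → Incident (spineV i) (spineV (suc i))
  ve : ∀ i → Incident (spineV i) (spineE i)
  ev : ∀ i → Incident (spineV (suc i)) (spineE i)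
  vl : ∀ i r → Incident (spineV i) (leafV i r)
  vp : ∀ i r → Incident (spineV i) (leafE i r)
  ee : ∀ i → Incident (spineE i) (spineE (suc i))
  ep : ∀ i r → Incident (spineE i) (leafE i r)
  ep⁺ : ∀ i r → Incident (spineE i) (leafE (suc i) r)
  pp : ∀ i {r r′} → r ≢ r′ → Incident (leafE i r) (leafE i r′)
  lp : ∀ i r → Incident (leafV i r) (leafE i r)

_~ᶜ_ : Code → Code → Set
c ~ᶜ c′ = Incident c c′ ⊎ Incident c′ c

module CaterpillarCode (G : Graph) (cat : IsCaterpillar G) where
  open Graph G using (n; adj)
  open Adjacency G
  open Caterpillar G cat

  codeV : Fin n → Code
  codeV v with v ∈P?
  ... | yes _ = spineV (index v)
  ... | no _  = leafV (index (parent v)) (rank v)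

  -- The last clause is junk: no edge joins two leaves.
  codeE : Fin n → Fin n → Code
  codeE u v with u ∈P? | v ∈P?
  ... | yes _ | yes _ = spineE (index u ⊓ index v)
  ... | yes _ | no _  = leafE (index u) (rank v)
  ... | no _  | yes _ = leafE (index v) (rank u)
  ... | no _  | no _  = spineE 0

  code : Element G → Code
  code (inj₁ v) = codeV v
  code (inj₂ ((u , v) , _)) = codeE u v

  codeE-comm : ∀ u v → codeE u v ≡ codeE v u
  codeE-comm u v with u ∈P? | v ∈P?
  ... | yes _ | yes _ = cong spineE (⊓-comm (index u) (index v))
  ... | yes _ | no _  = refl
  ... | no _  | yes _ = refl
  ... | no _  | no _  = refl

  code-edgeOf : ∀ {u v} → adj u v ≡ true → code (edgeOf u v) ≡ codeE u v
  code-edgeOf uv with edgeOf-≡ uv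
  ... | ((u , v) , _) , eq , inj₁ refl rewrite eq = refl
  ... | ((u , v) , _) , eq , inj₂ refl rewrite eq = codeE-comm u v

  codeV-∈P : ∀ {v} → v ∈ P → codeV v ≡ spineV (index v)
  codeV-∈P {v} v∈ with v ∈P?
  ... | yes _  = refl
  ... | no v∉  = contradiction v∈ v∉

  codeV-∉P : ∀ {v} → v ∉ P → codeV v ≡ leafV (index (parent v)) (rank v)
  codeV-∉P {v} v∉ with v ∈P?
  ... | yes v∈ = contradiction v∈ v∉
  ... | no _   = refl

  codeE-∈P∈P : ∀ {u v} → u ∈ P → v ∈ P → codeE u v ≡ spineE (index u ⊓ index v)
  codeE-∈P∈P {u} {v} u∈ v∈ with u ∈P? | v ∈P?
  ... | yes _ | yes _  = refl
  ... | no u∉ | _      = contradiction u∈ u∉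
  ... | yes _ | no v∉  = contradiction v∈ v∉

  codeE-∈P∉P : ∀ {u v} → u ∈ P → v ∉ P → codeE u v ≡ leafE (index u) (rank v)
  codeE-∈P∉P {u} {v} u∈ v∉ with u ∈P? | v ∈P?
  ... | yes _ | no _   = refl
  ... | no u∉ | _      = contradiction u∈ u∉
  ... | yes _ | yes v∈ = contradiction v∈ v∉

  code-p : ∀ {i} → i < s → code (inj₁ (p i)) ≡ spineV i
  code-p i< = trans (codeV-∈P (p∈P i<)) (cong spineV (index-p i<))

  code-spineEdge : ∀ {i} → suc i < s → code (edgeOf (p i) (p (suc i))) ≡ spineE i
  code-spineEdge {i} i+1< = begin
    code (edgeOf (p i) (p (suc i)))    ≡⟨ code-edgeOf (p-adj i+1<) ⟩
    codeE (p i) (p (suc i))            ≡⟨ codeE-∈P∈P (p∈P i<) (p∈P i+1<) ⟩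
    spineE (index (p i) ⊓ index (p (suc i))) ≡⟨ cong₂ (λ j k → spineE (j ⊓ k)) (index-p i<) (index-p i+1<) ⟩
    spineE (i ⊓ suc i)                 ≡⟨ cong spineE (m≤n⇒m⊓n≡m (n≤1+n i)) ⟩
    spineE i                           ∎
    where
    open ≡-Reasoning
    i< : i < s
    i< = <-trans (n<1+n i) i+1<

  code-leaf : ∀ {i r} → i < s → r < a i → code (inj₁ (leaf i r)) ≡ leafV i r
  code-leaf i< r< = trans (codeV-∉P (leaf∉P r<))
    (cong₂ leafV (trans (cong index (parent-≡ (leaf∉P r<) (Adj-sym (leaf-adj r<)))) (index-p i<)) (rank-leaf r<))

  code-pendant : ∀ {i r} → i < s → r < a i → code (edgeOf (p i) (leaf i r)) ≡ leafE i r
  code-pendant i< r< = trans (code-edgeOf (leaf-adj r<))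
    (trans (codeE-∈P∉P (p∈P i<) (leaf∉P r<)) (cong₂ leafE (index-p i<) (rank-leaf r<)))

  Valid : Code → Set
  Valid (spineV i)  = i < s
  Valid (spineE i)  = suc i < s
  Valid (leafV i r) = i < s × r < a i
  Valid (leafE i r) = i < s × r < a i

  module _ (P≢[] : 1 ≤ s) where
    open NonEmpty P≢[]

    code-valid : ∀ x → Valid (code x)
    code-valid (inj₁ v) with v ∈P?
    ... | yes v∈ = index-< v∈
    ... | no v∉  = index-parent< v∉ , rank< v∉ (Adj-sym (∉P⇒parent v∉)) (∉P⇒adj∈P v∉ (∉P⇒parent v∉))
    code-valid (inj₂ ((u , v) , _ , uv)) with u ∈P? | v ∈P?
    ... | yes u∈ | yes v∈ with index-adj u∈ v∈ uv
    ...   | inj₁ v≡ rewrite v≡ | m≤n⇒m⊓n≡m (n≤1+n (index u)) = subst (_< s) v≡ (index-< v∈)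
    ...   | inj₂ u≡ rewrite u≡ | m≥n⇒m⊓n≡n (n≤1+n (index v)) = subst (_< s) u≡ (index-< u∈)
    code-valid (inj₂ ((u , v) , _ , uv)) | yes u∈ | no v∉ = index-< u∈ , rank< v∉ uv u∈
    code-valid (inj₂ ((u , v) , _ , uv)) | no u∉  | yes v∈ = index-< v∈ , rank< u∉ (Adj-sym uv) v∈
    code-valid (inj₂ ((u , v) , _ , uv)) | no u∉  | no v∉ = contradiction (∉P⇒adj∈P u∉ uv) v∉

    private
      ⊓-suc : ∀ m → m ⊓ suc m ≡ m
      ⊓-suc m = m≤n⇒m⊓n≡m (n≤1+n m)

      suc-⊓ : ∀ m → suc m ⊓ m ≡ m
      suc-⊓ m = m≥n⇒m⊓n≡n (n≤1+n m)

    codeV-~ : ∀ {u v} → adj u v ≡ true → codeV u ~ᶜ codeV v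
    codeV-~ {u} {v} uv with u ∈P? | v ∈P?
    ... | yes u∈ | yes v∈ with index-adj u∈ v∈ uv
    ...   | inj₁ v≡ rewrite v≡ = inj₁ (vv _)
    ...   | inj₂ u≡ rewrite u≡ = inj₂ (vv _)
    codeV-~ uv | yes u∈ | no v∉ rewrite parent-≡ v∉ (Adj-sym uv) = inj₁ (vl _ _)
    codeV-~ uv | no u∉  | yes v∈ rewrite parent-≡ u∉ uv = inj₂ (vl _ _)
    codeV-~ uv | no u∉  | no v∉ = contradiction (∉P⇒adj∈P u∉ uv) v∉

    codeV-codeE-~ : ∀ {u v} → adj u v ≡ true → codeV u ~ᶜ codeE u v
    codeV-codeE-~ {u} {v} uv with u ∈P? | v ∈P?
    ... | yes u∈ | yes v∈ with index-adj u∈ v∈ uv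
    ...   | inj₁ v≡ rewrite v≡ | ⊓-suc (index u) = inj₁ (ve _)
    ...   | inj₂ u≡ rewrite u≡ | suc-⊓ (index v) = inj₁ (ev _)
    codeV-codeE-~ uv | yes u∈ | no v∉ = inj₁ (vp _ _)
    codeV-codeE-~ uv | no u∉  | yes v∈ rewrite parent-≡ u∉ uv = inj₁ (lp _ _)
    codeV-codeE-~ uv | no u∉  | no v∉ = contradiction (∉P⇒adj∈P u∉ uv) v∉

    codeE-codeE-~ : ∀ {u v w} → adj u v ≡ true → adj u w ≡ true → v ≢ w → codeE u v ~ᶜ codeE u w
    codeE-codeE-~ {u} {v} {w} uv uw v≢w with u ∈P?
    ... | no u∉ = contradiction (∉P-adj-unique u∉ uv uw) v≢w
    ... | yes u∈ with v ∈P? | w ∈P?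
    ...   | yes v∈ | yes w∈ with index-adj u∈ v∈ uv | index-adj u∈ w∈ uw
    ...     | inj₁ v≡ | inj₁ w≡ = contradiction (position-injective Fin._≟_ v∈ w∈ (trans v≡ (sym w≡))) v≢w
    ...     | inj₂ u≡ | inj₂ u≡′ = contradiction (position-injective Fin._≟_ v∈ w∈ (suc-injective (trans (sym u≡) u≡′))) v≢w
    ...     | inj₁ v≡ | inj₂ u≡ rewrite v≡ | ⊓-suc (index u) | u≡ | suc-⊓ (index w) = inj₂ (ee _)
    ...     | inj₂ u≡ | inj₁ w≡ rewrite w≡ | ⊓-suc (index u) | u≡ | suc-⊓ (index v) = inj₁ (ee _)
    codeE-codeE-~ {u} {v} {w} uv uw v≢w | yes u∈ | yes v∈ | no w∉ with index-adj u∈ v∈ uv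
    ...     | inj₁ v≡ rewrite v≡ | ⊓-suc (index u) = inj₁ (ep _ _)
    ...     | inj₂ u≡ rewrite u≡ | suc-⊓ (index v) = inj₁ (ep⁺ _ _)
    codeE-codeE-~ {u} {v} {w} uv uw v≢w | yes u∈ | no v∉ | yes w∈ with index-adj u∈ w∈ uw
    ...     | inj₁ w≡ rewrite w≡ | ⊓-suc (index u) = inj₂ (ep _ _)
    ...     | inj₂ u≡ rewrite u≡ | suc-⊓ (index w) = inj₂ (ep⁺ _ _)
    codeE-codeE-~ {u} {v} {w} uv uw v≢w | yes u∈ | no v∉ | no w∉ = inj₁ (pp _ (rank-ne v∉ w∉ uv uw v≢w))

    code-~ : ∀ {x y} → x ~ y → code x ~ᶜ code y
    code-~ (vertex~vertex uv) = codeV-~ uv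
    code-~ (vertex~edge uv) rewrite code-edgeOf uv = codeV-codeE-~ uv
    code-~ (edge~vertex uv) rewrite code-edgeOf uv = Sum.swap (codeV-codeE-~ uv)
    code-~ (edge~edge uv uw v≢w) rewrite code-edgeOf uv | code-edgeOf uw = codeE-codeE-~ uv uw v≢w

-- Total b-chromatic colourings

module BChromatic (G : Graph) {k} (c : Element G → Fin k) where
  open Adjacency G

  Sees : Element G → Fin k → Set
  Sees x j = ∃[ y ] x ~ y × c y ≡ j

  SeesAllOthers : Element G → Set
  SeesAllOthers x = ∀ j → j ≢ c x → Sees x j

  Rainbow : Fin k → Set
  Rainbow j = ∃[ x ] c x ≡ j × SeesAllOthers x

  Covers : Fin k → List (Fin k) → Set
  Covers a js = ∀ j → j ≡ a ⊎ j ∈ js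

  covers? : ∀ a js → Dec (Covers a js)
  covers? a js = Fin.all? λ j → (j Fin.≟ a) ⊎-dec (j ∈? js)
    where open import Data.List.Membership.DecPropositional (Fin._≟_ {k}) using (_∈?_)

  seesAllOthers : ∀ {x a} → c x ≡ a → ∀ js → All (Sees x) js → {True (covers? a js)} → SeesAllOthers x
  seesAllOthers {x} refl js sees {covers} j j≢cx with toWitness covers j
  ... | inj₁ j≡cx = contradiction j≡cx j≢cx
  ... | inj₂ j∈js = All.lookup sees j∈js

  module _ (proper : ∀ {x y} → x ~ y → c x ≢ c y) where

    bChromaticColouring : (∀ j → Rainbow j) → HasTotalBChromaticColouring G k
    bChromaticColouring witness =
      c , ((λ j → proj₁ (witness j) , proj₁ (proj₂ (witness j))) , (λ x y h → proper (adjElem⇒~ x y h))) ,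
      λ j → proj₁ (witness j) , proj₁ (proj₂ (witness j)) , b-chromatic (proj₂ (proj₂ (witness j)))
      where
      b-chromatic : ∀ {x} → SeesAllOthers x → IsTotalBChromaticElem G k c x
      b-chromatic {x} sees j = mk⇔ (λ j≢cx → Product.map₂ (Product.map₁ ~⇒adjElem) (sees j j≢cx))
                                   (λ { (y , xy , refl) cy≡cx → proper (adjElem⇒~ x y xy) (sym cy≡cx) })

module CodeColouring (G : Graph) (cat : IsCaterpillar G) (P≢[] : 1 ≤ Caterpillar.s G cat) {k} (W : Code → Set)
                     (colour : Code → Fin k) (valid⇒W : ∀ {c} → CaterpillarCode.Valid G cat c → W c)
                     (colour-proper : ∀ {c c′} → Incident c c′ → W c → W c′ → colour c ≢ colour c′) where
  open Adjacency G
  open CaterpillarCode G cat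

  c : Element G → Fin k
  c x = colour (code x)

  proper : ∀ {x y} → x ~ y → c x ≢ c y
  proper {x} {y} x~y with code-~ P≢[] x~y
  ... | inj₁ x→y = colour-proper x→y (valid⇒W (code-valid P≢[] x)) (valid⇒W (code-valid P≢[] y))
  ... | inj₂ y→x = colour-proper y→x (valid⇒W (code-valid P≢[] y)) (valid⇒W (code-valid P≢[] x)) ∘ sym

  open BChromatic G c public

pattern c₀ = zero
pattern c₁ = suc c₀
pattern c₂ = suc c₁
pattern c₃ = suc c₂
pattern c₄ = suc c₃

rot : Fin 5 → Fin 5
rot c₀ = c₁
rot c₁ = c₂
rot c₂ = c₃
rot c₃ = c₄
rot c₄ = c₀

-- shift d z = z + d in ℤ/5
shift : ℕ → Fin 5 → Fin 5
shift zero z = z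
shift (suc d) z = rot (shift d z)

shift-shift : ∀ d e z → shift d (shift e z) ≡ shift (d + e) z
shift-shift zero e z = refl
shift-shift (suc d) e z = cong rot (shift-shift d e z)

-- d and d′ are distinct modulo 5
_≢₅_ : ℕ → ℕ → Set
d ≢₅ d′ = ∀ z → shift d z ≢ shift d′ z

_≢₅?_ : ∀ d d′ → Dec (d ≢₅ d′)
d ≢₅? d′ = Fin.all? λ z → ¬? (shift d z Fin.≟ shift d′ z)

≢₅-sym : ∀ {d d′} → d ≢₅ d′ → d′ ≢₅ d
≢₅-sym d≢d′ z = d≢d′ z ∘ sym

AllPairs-lookupOr : ∀ {A : Set} {R : A → A → Set} → (∀ {x y} → R x y → R y x) → ∀ d {xs} → AllPairs R xs →
                    ∀ {i j} → i < length xs → j < length xs → i ≢ j → R (lookupOr d xs i) (lookupOr d xs j)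
AllPairs-lookupOr R-sym d {x ∷ xs} (Rx ∷ Rxs) {zero}  {zero}  _ _ 0≢0 = contradiction refl 0≢0
AllPairs-lookupOr R-sym d {x ∷ xs} (Rx ∷ Rxs) {zero}  {suc j} _ (s≤s j<) _ = All.lookup Rx (lookupOr-∈ d j j<)
AllPairs-lookupOr R-sym d {x ∷ xs} (Rx ∷ Rxs) {suc i} {zero}  (s≤s i<) _ _ = R-sym (All.lookup Rx (lookupOr-∈ d i i<))
AllPairs-lookupOr R-sym d {x ∷ xs} (Rx ∷ Rxs) {suc i} {suc j} (s≤s i<) (s≤s j<) i≢j =
  AllPairs-lookupOr R-sym d Rxs i< j< (i≢j ∘ cong suc)

-- The colouring for spines with at least three vertices: spine vertex i gets 2i and spine edge i gets 2i + 1 (in ℤ/5),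
-- and a pendant edge (leaf) at spine vertex i gets 2i + d (2i + 2d) for an offset d read off the table below.
module SpineColouring (s : ℕ) where

  data Place : Set where
    first middle last : Place

  place : ℕ → Place
  place zero = first
  place (suc i) with suc (suc i) ≟ s
  ... | yes _ = last
  ... | no _  = middle

  -- Offsets avoid 0 and the offsets ±1 of the spine edges at the vertex; the first pendant edge at the
  -- last vertex gets offset 1, and hence colour 0 when s = 3, as the spine edge 1 must see colour 0.
  offsets : Place → List ℕ
  offsets first  = 4 ∷ 3 ∷ 2 ∷ []
  offsets middle = 3 ∷ 2 ∷ []
  offsets last   = 1 ∷ 3 ∷ 2 ∷ []

  capacity : Place → ℕ
  capacity pl = length (offsets pl)

  offset : ℕ → ℕ → ℕ
  offset i = lookupOr 0 (offsets (place i))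

  base : ℕ → Fin 5
  base zero = c₀
  base (suc i) = shift 2 (base i)

  colour : Code → Fin 5
  colour (spineV i) = base i
  colour (spineE i) = shift 1 (base i)
  colour (leafE i r) = shift (offset i r) (base i)
  colour (leafV i r) = shift (offset i r + offset i r) (base i)

  W : Code → Set
  W (spineV _) = ⊤
  W (spineE i) = suc i < s
  W (leafV i r) = r < capacity (place i)
  W (leafE i r) = r < capacity (place i)

  Admissible : ℕ → Set
  Admissible d = 0 ≢₅ d × 0 ≢₅ (d + d) × (d + d) ≢₅ d

  admissible? : ∀ d → Dec (Admissible d)
  admissible? d = (0 ≢₅? d) ×-dec (0 ≢₅? (d + d)) ×-dec ((d + d) ≢₅? d)

  offsets-admissible : ∀ pl → All Admissible (offsets pl)
  offsets-admissible first  = from-yes (All.all? admissible? (offsets first))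
  offsets-admissible middle = from-yes (All.all? admissible? (offsets middle))
  offsets-admissible last   = from-yes (All.all? admissible? (offsets last))

  offsets-distinct : ∀ pl → AllPairs _≢₅_ (offsets pl)
  offsets-distinct first  = from-yes (AllPairs.allPairs? _≢₅?_ (offsets first))
  offsets-distinct middle = from-yes (AllPairs.allPairs? _≢₅?_ (offsets middle))
  offsets-distinct last   = from-yes (AllPairs.allPairs? _≢₅?_ (offsets last))

  offsets-avoid-next : ∀ pl → pl ≢ last → All (1 ≢₅_) (offsets pl)
  offsets-avoid-next first  _ = from-yes (All.all? (1 ≢₅?_) (offsets first))
  offsets-avoid-next middle _ = from-yes (All.all? (1 ≢₅?_) (offsets middle))
  offsets-avoid-next last   l≢l = contradiction refl l≢l

  offsets-avoid-previous : ∀ pl → pl ≢ first → All (λ d → 1 ≢₅ (d + 2)) (offsets pl)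
  offsets-avoid-previous first  f≢f = contradiction refl f≢f
  offsets-avoid-previous middle _ = from-yes (All.all? (λ d → 1 ≢₅? (d + 2)) (offsets middle))
  offsets-avoid-previous last   _ = from-yes (All.all? (λ d → 1 ≢₅? (d + 2)) (offsets last))

  place-suc≢first : ∀ i → place (suc i) ≢ first
  place-suc≢first i with suc (suc i) ≟ s
  ... | yes _ = λ ()
  ... | no _  = λ ()

  place≢last : ∀ i → suc i < s → place i ≢ last
  place≢last zero _ ()
  place≢last (suc i) i+1< with suc (suc i) ≟ s
  ... | yes i+2≡s = contradiction (subst (suc (suc i) <_) (sym i+2≡s) i+1<) (<-irrefl refl)
  ... | no _      = λ ()

  private
    offset-property : ∀ {P : ℕ → Set} i {r} → All P (offsets (place i)) → r < capacity (place i) → P (offset i r)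
    offset-property i {r} all r< = All.lookup all (lookupOr-∈ 0 r r<)

  colour-proper : ∀ {c c′} → Incident c c′ → W c → W c′ → colour c ≢ colour c′
  colour-proper (vv i) _ _ = from-yes (0 ≢₅? 2) (base i)
  colour-proper (ve i) _ _ = from-yes (0 ≢₅? 1) (base i)
  colour-proper (ev i) _ _ = from-yes (2 ≢₅? 1) (base i)
  colour-proper (vl i r) _ r< = proj₁ (proj₂ (offset-property i (offsets-admissible (place i)) r<)) (base i)
  colour-proper (vp i r) _ r< = proj₁ (offset-property i (offsets-admissible (place i)) r<) (base i)
  colour-proper (ee i) _ _ = from-yes (1 ≢₅? 3) (base i)
  colour-proper (ep i r) i+1< r< = offset-property i (offsets-avoid-next (place i) (place≢last i i+1<)) r< (base i)
  colour-proper (ep⁺ i r) _ r< eq = offset-property (suc i) (offsets-avoid-previous (place (suc i)) (place-suc≢first i)) r< (base i)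
    (trans eq (shift-shift (offset (suc i) r) 2 (base i)))
  colour-proper (pp i r≢r′) r< r′< = AllPairs-lookupOr {R = _≢₅_} (λ {d} {d′} → ≢₅-sym {d} {d′}) 0 (offsets-distinct (place i)) r< r′< r≢r′ (base i)
  colour-proper (lp i r) r< _ = proj₂ (proj₂ (offset-property i (offsets-admissible (place i)) r<)) (base i)

-- A single leaf at pᵢ gets 4, so that pᵢ sees 4; otherwise the first two leaves at pᵢ get the colour of
-- the other spine vertex, which the pendant edges 0 and 1 at pᵢ must see when pᵢ has just two leaves.
module DoubleStarColouring (a₀ a₁ : ℕ) where

  pendantColours : ℕ → List (Fin 5)
  pendantColours zero    = c₃ ∷ c₄ ∷ c₂ ∷ []
  pendantColours (suc _) = c₃ ∷ c₄ ∷ c₀ ∷ []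

  leafColour : Fin 5 → ℕ → ℕ → Fin 5
  leafColour other (suc zero) _ = c₄
  leafColour other _ (suc (suc _)) = c₁
  leafColour other _ _ = other

  leaves : ℕ → ℕ
  leaves zero = a₀
  leaves (suc _) = a₁

  colour : Code → Fin 5
  colour (spineV zero) = c₀
  colour (spineV (suc _)) = c₂
  colour (spineE _) = c₁
  colour (leafE i r) = lookupOr c₁ (pendantColours i) r
  colour (leafV zero r) = leafColour c₂ a₀ r
  colour (leafV (suc _) r) = leafColour c₀ a₁ r

  W : Code → Set
  W (spineV i) = i < 2
  W (spineE i) = suc i < 2
  W (leafV i r) = i < 2 × r < leaves i
  W (leafE i r) = i < 2 × r < leaves i

  leafColour∈ : ∀ other a r → leafColour other a r ∈ c₄ ∷ c₁ ∷ other ∷ []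
  leafColour∈ other (suc zero) r = here refl
  leafColour∈ other zero (suc (suc r)) = there (here refl)
  leafColour∈ other (suc (suc a)) (suc (suc r)) = there (here refl)
  leafColour∈ other zero zero = there (there (here refl))
  leafColour∈ other zero (suc zero) = there (there (here refl))
  leafColour∈ other (suc (suc a)) zero = there (there (here refl))
  leafColour∈ other (suc (suc a)) (suc zero) = there (there (here refl))

  ∉⇒≢ : ∀ (x : Fin 5) ys → {True (All.all? (λ y → ¬? (x Fin.≟ y)) ys)} → ∀ {y} → y ∈ ys → x ≢ y
  ∉⇒≢ x ys {x∉ys} = All.lookup (toWitness x∉ys)

  leaf≢pendant : ∀ other a r → r < a → a ≤ 3 → other ≢ c₃ → other ≢ c₄ → ∀ {z} → z ≢ c₁ →
                 leafColour other a r ≢ lookupOr c₁ (c₃ ∷ c₄ ∷ z ∷ []) r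
  leaf≢pendant other (suc zero) zero _ _ _ _ _ = λ ()
  leaf≢pendant other (suc zero) (suc r) (s≤s ()) _
  leaf≢pendant other zero r () _
  leaf≢pendant other (suc (suc a)) zero _ _ o≢3 _ _ = o≢3
  leaf≢pendant other (suc (suc a)) (suc zero) _ _ _ o≢4 _ = o≢4
  leaf≢pendant other (suc (suc a)) (suc (suc zero)) _ _ _ _ z≢1 = z≢1 ∘ sym
  leaf≢pendant other (suc (suc a)) (suc (suc (suc r))) (s≤s (s≤s (s≤s (s≤s _)))) (s≤s (s≤s (s≤s ())))

  module _ (a₀≤3 : a₀ ≤ 3) (a₁≤3 : a₁ ≤ 3) where

    <leaves⇒<3 : ∀ i {r} → r < leaves i → r < length (pendantColours i)
    <leaves⇒<3 zero    r< = <-≤-trans r< a₀≤3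
    <leaves⇒<3 (suc _) r< = <-≤-trans r< a₁≤3

    pendantColours-distinct : ∀ i → AllPairs _≢_ (pendantColours i)
    pendantColours-distinct zero    = from-yes (AllPairs.allPairs? (λ x y → ¬? (x Fin.≟ y)) (pendantColours zero))
    pendantColours-distinct (suc _) = from-yes (AllPairs.allPairs? (λ x y → ¬? (x Fin.≟ y)) (pendantColours 1))

    colour-proper : ∀ {c c′} → Incident c c′ → W c → W c′ → colour c ≢ colour c′
    colour-proper (vv zero)    _ _ = λ ()
    colour-proper (vv (suc i)) _ (s≤s (s≤s ()))
    colour-proper (ve zero)    _ _ = λ ()
    colour-proper (ve (suc i)) _ (s≤s (s≤s ()))
    colour-proper (ev zero)    _ _ = λ ()
    colour-proper (ev (suc i)) _ (s≤s (s≤s ()))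
    colour-proper (vl zero r)    _ _ = ∉⇒≢ c₀ (c₄ ∷ c₁ ∷ c₂ ∷ []) (leafColour∈ c₂ a₀ r)
    colour-proper (vl (suc i) r) _ _ = ∉⇒≢ c₂ (c₄ ∷ c₁ ∷ c₀ ∷ []) (leafColour∈ c₀ a₁ r)
    colour-proper (vp zero r)    _ (_ , r<) = ∉⇒≢ c₀ (pendantColours 0) (lookupOr-∈ c₁ r (<leaves⇒<3 0 r<))
    colour-proper (vp (suc i) r) _ (_ , r<) = ∉⇒≢ c₂ (pendantColours 1) (lookupOr-∈ c₁ r (<leaves⇒<3 1 r<))
    colour-proper (ee i) _ (s≤s (s≤s ()))
    colour-proper (ep zero r)    _ (_ , r<) = ∉⇒≢ c₁ (pendantColours 0) (lookupOr-∈ c₁ r (<leaves⇒<3 0 r<))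
    colour-proper (ep (suc i) r) _ (_ , r<) = ∉⇒≢ c₁ (pendantColours 1) (lookupOr-∈ c₁ r (<leaves⇒<3 1 r<))
    colour-proper (ep⁺ i r)      _ (_ , r<) = ∉⇒≢ c₁ (pendantColours 1) (lookupOr-∈ c₁ r (<leaves⇒<3 1 r<))
    colour-proper (pp i r≢r′) (_ , r<) (_ , r′<) =
      AllPairs-lookupOr ≢-sym c₁ (pendantColours-distinct i) (<leaves⇒<3 i r<) (<leaves⇒<3 i r′<) r≢r′
    colour-proper (lp zero r)    (_ , r<) _ = leaf≢pendant c₂ a₀ r r< a₀≤3 (λ ()) (λ ()) (λ ())
    colour-proper (lp (suc i) r) (_ , r<) _ = leaf≢pendant c₀ a₁ r r< a₁≤3 (λ ()) (λ ()) (λ ())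

module P₄Colouring where

  colour : Code → Fin 4
  colour (spineV zero)    = c₂
  colour (spineV (suc _)) = c₀
  colour (spineE _)       = c₃
  colour (leafE _ _)      = c₁
  colour (leafV zero _)   = c₀
  colour (leafV (suc _) _) = c₂

  W : Code → Set
  W (spineV i)  = i < 2
  W (spineE i)  = suc i < 2
  W (leafV i r) = i < 2 × r < 1
  W (leafE i r) = i < 2 × r < 1

  colour-proper : ∀ {c c′} → Incident c c′ → W c → W c′ → colour c ≢ colour c′
  colour-proper (vv zero)       _ _ = λ ()
  colour-proper (vv (suc i))    _ (s≤s (s≤s ()))
  colour-proper (ve zero)       _ _ = λ ()
  colour-proper (ve (suc i))    _ (s≤s (s≤s ()))
  colour-proper (ev zero)       _ _ = λ ()
  colour-proper (ev (suc i))    _ (s≤s (s≤s ()))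
  colour-proper (vl zero r)     _ _ = λ ()
  colour-proper (vl (suc i) r)  _ _ = λ ()
  colour-proper (vp zero r)     _ _ = λ ()
  colour-proper (vp (suc i) r)  _ _ = λ ()
  colour-proper (ee i)          _ (s≤s (s≤s ()))
  colour-proper (ep i r)        _ _ = λ ()
  colour-proper (ep⁺ i r)       _ _ = λ ()
  colour-proper (pp i {zero} {zero} 0≢0) _ _ = contradiction refl 0≢0
  colour-proper (pp i {suc r} r≢r′) (_ , s≤s ()) _
  colour-proper (pp i {zero} {suc r′} r≢r′) _ (_ , s≤s ())
  colour-proper (lp zero r)     _ _ = λ ()
  colour-proper (lp (suc i) r)  _ _ = λ ()

module StarColouring (a : ℕ) where

  colour : Code → Fin (suc a)
  colour (spineV _)        = c₀
  colour (spineE _)        = c₀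
  colour (leafE _ r)       = suc r mod suc a
  colour (leafV _ zero)    = 2 mod suc a
  colour (leafV _ (suc _)) = 1 mod suc a

  W : Code → Set
  W (spineV i)  = i < 1
  W (spineE i)  = suc i < 1
  W (leafV i r) = i < 1 × r < a
  W (leafE i r) = i < 1 × r < a

  toℕ-mod : ∀ {m} → m ≤ a → toℕ (m mod suc a) ≡ m
  toℕ-mod m≤a = trans (toℕ-fromℕ< _) (m<n⇒m%n≡m (s≤s m≤a))

  mod-injective : ∀ {m m′} → m ≤ a → m′ ≤ a → m mod suc a ≡ m′ mod suc a → m ≡ m′
  mod-injective m≤a m′≤a eq = trans (sym (toℕ-mod m≤a)) (trans (cong toℕ eq) (toℕ-mod m′≤a))

  module _ (2≤a : 2 ≤ a) where

    1≤a : 1 ≤ a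
    1≤a = ≤-trans (s≤s z≤n) 2≤a

    0≢mod : ∀ {m} → 1 ≤ m → m ≤ a → c₀ ≢ m mod suc a
    0≢mod {suc m} _ m≤a eq with () ← trans (cong toℕ eq) (toℕ-mod m≤a)

    colour-proper : ∀ {c c′} → Incident c c′ → W c → W c′ → colour c ≢ colour c′
    colour-proper (vv i) _ (s≤s ())
    colour-proper (ve i) _ (s≤s ())
    colour-proper (ev i) (s≤s ()) _
    colour-proper (vl i zero) _ _    = 0≢mod (s≤s z≤n) 2≤a
    colour-proper (vl i (suc r)) _ _ = 0≢mod (s≤s z≤n) 1≤a
    colour-proper (vp i r) _ (_ , r<) = 0≢mod (s≤s z≤n) r<
    colour-proper (ee i) (s≤s ()) _
    colour-proper (ep i r) (s≤s ()) _
    colour-proper (ep⁺ i r) (s≤s ()) _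
    colour-proper (pp i r≢r′) (_ , r<) (_ , r′<) = r≢r′ ∘ suc-injective ∘ mod-injective r< r′<
    colour-proper (lp i zero) _ _ eq with () ← mod-injective 2≤a 1≤a eq
    colour-proper (lp i (suc r)) _ (_ , r<) eq with () ← mod-injective 1≤a r< eq

-- The caterpillars with m_t ≤ 5

module LongSpine (G : Graph) (cat : IsCaterpillar G) (m≤5 : mT G ≤ 5) (3≤s : 3 ≤ Caterpillar.s G cat) where
  open Graph G using (n; adj)
  open Adjacency G
  open Caterpillar G cat
  open CaterpillarCode G cat
  open SpineColouring s

  private
    0<s : 0 < s
    0<s = <-trans (s≤s z≤n) 3≤s
    1<s : 1 < s
    1<s = <-trans (s≤s (s≤s z≤n)) 3≤s

  a≤capacity : ∀ i → i < s → a i ≤ capacity (place i)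
  a≤capacity zero _ = a-first≤3 m≤5 1<s
  a≤capacity (suc i) i+1< with suc (suc i) ≟ s
  ... | yes i+2≡s = a-last≤3 m≤5 i i+2≡s
  ... | no i+2≢s  = a-middle≤2 m≤5 i (≤∧≢⇒< i+1< i+2≢s)

  valid⇒W : ∀ {c} → Valid c → W c
  valid⇒W {spineV _}  _          = tt
  valid⇒W {spineE _}  i+1<       = i+1<
  valid⇒W {leafV i _} (i< , r<)  = <-≤-trans r< (a≤capacity i i<)
  valid⇒W {leafE i _} (i< , r<)  = <-≤-trans r< (a≤capacity i i<)

  open CodeColouring G cat 0<s W colour valid⇒W colour-proper

  offset-last : ∀ i → suc (suc i) ≡ s → offset (suc i) 0 ≡ 1
  offset-last i i+2≡s with suc (suc i) ≟ s
  ... | yes _     = refl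
  ... | no i+2≢s  = contradiction i+2≡s i+2≢s

  -- The rainbow elements p₀, p₀p₁, p₁, p₁p₂, p₂ get the colours 0, …, 4.  Besides them they see a leaf ℓ at p₀
  -- and an element t beyond p₂: the vertex p₃, or else a leaf at the last vertex p₂.
  p₀ p₁ p₂ ℓ : Fin n
  p₀ = p 0
  p₁ = p 1
  p₂ = p 2
  ℓ = leaf 0 0

  p₀p₁ : adj p₀ p₁ ≡ true
  p₀p₁ = p-adj 1<s
  p₁p₂ : adj p₁ p₂ ≡ true
  p₁p₂ = p-adj 3≤s
  p₀ℓ : adj p₀ ℓ ≡ true
  p₀ℓ = leaf-adj (1≤a-first 1<s)

  Beyond : Set
  Beyond = ∃[ t ] adj p₂ t ≡ true × p₁ ≢ t × c (edgeOf p₂ t) ≡ c₀ × c (inj₁ t) ≡ c₁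

  beyond : Beyond
  beyond with m≤n⇒m<n∨m≡n 3≤s
  ... | inj₁ 3<s = p 3 , p-adj 3<s , (λ eq → contradiction (p-injective 1<s 3<s eq) λ ()) ,
                   cong colour (code-spineEdge 3<s) , cong colour (code-p 3<s)
  ... | inj₂ 3≡s = leaf 2 0 , leaf-adj 0<a₂ , p≢leaf 1<s 0<a₂ ,
                   trans (cong colour (code-pendant 3≤s 0<a₂)) (cong (λ d → shift d c₄) (offset-last 1 3≡s)) ,
                   trans (cong colour (code-leaf 3≤s 0<a₂)) (cong (λ d → shift (d + d) c₄) (offset-last 1 3≡s))
    where
    0<a₂ : 0 < a 2
    0<a₂ = 1≤a-last 1 3≡s

  c-p₀ : c (inj₁ p₀) ≡ c₀
  c-p₀ = cong colour (code-p 0<s)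
  c-p₁ : c (inj₁ p₁) ≡ c₂
  c-p₁ = cong colour (code-p 1<s)
  c-p₂ : c (inj₁ p₂) ≡ c₄
  c-p₂ = cong colour (code-p 3≤s)
  c-p₀p₁ : c (edgeOf p₀ p₁) ≡ c₁
  c-p₀p₁ = cong colour (code-spineEdge 1<s)
  c-p₁p₂ : c (edgeOf p₁ p₂) ≡ c₃
  c-p₁p₂ = cong colour (code-spineEdge 3≤s)
  c-ℓ : c (inj₁ ℓ) ≡ c₃
  c-ℓ = cong colour (code-leaf 0<s (1≤a-first 1<s))
  c-p₀ℓ : c (edgeOf p₀ ℓ) ≡ c₄
  c-p₀ℓ = cong colour (code-pendant 0<s (1≤a-first 1<s))
  p₀≢p₂ : p₀ ≢ p₂
  p₀≢p₂ eq = contradiction (p-injective 0<s 3≤s eq) λ ()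
  p₁≢ℓ : p₁ ≢ ℓ
  p₁≢ℓ = p≢leaf 1<s (1≤a-first 1<s)

  has5 : HasTotalBChromaticColouring G 5
  has5 with t , p₂t , p₁≢t , c-p₂t , c-t ← beyond = bChromaticColouring proper λ
    { c₀ → inj₁ p₀ , c-p₀ , seesAllOthers c-p₀ (c₁ ∷ c₂ ∷ c₃ ∷ c₄ ∷ [])
             ((_ , vertex~edge p₀p₁ , c-p₀p₁) ∷ (_ , vertex~vertex p₀p₁ , c-p₁) ∷ (_ , vertex~vertex p₀ℓ , c-ℓ) ∷ (_ , vertex~edge p₀ℓ , c-p₀ℓ) ∷ [])
    ; c₁ → edgeOf p₀ p₁ , c-p₀p₁ , seesAllOthers c-p₀p₁ (c₀ ∷ c₂ ∷ c₃ ∷ c₄ ∷ [])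
             ((_ , edge~vertex p₀p₁ , c-p₀) ∷ (_ , edge~vertex′ p₀p₁ , c-p₁) ∷ (_ , edge~edge-path p₀p₁ p₁p₂ p₀≢p₂ , c-p₁p₂) ∷
              (_ , edge~edge p₀p₁ p₀ℓ p₁≢ℓ , c-p₀ℓ) ∷ [])
    ; c₂ → inj₁ p₁ , c-p₁ , seesAllOthers c-p₁ (c₀ ∷ c₁ ∷ c₃ ∷ c₄ ∷ [])
             ((_ , vertex~vertex (Adj-sym p₀p₁) , c-p₀) ∷ (_ , vertex~edge′ p₀p₁ , c-p₀p₁) ∷ (_ , vertex~edge p₁p₂ , c-p₁p₂) ∷
              (_ , vertex~vertex p₁p₂ , c-p₂) ∷ [])
    ; c₃ → edgeOf p₁ p₂ , c-p₁p₂ , seesAllOthers c-p₁p₂ (c₀ ∷ c₁ ∷ c₂ ∷ c₄ ∷ [])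
             ((_ , edge~edge-path p₁p₂ p₂t p₁≢t , c-p₂t) ∷ (_ , ~-sym (edge~edge-path p₀p₁ p₁p₂ p₀≢p₂) , c-p₀p₁) ∷
              (_ , edge~vertex p₁p₂ , c-p₁) ∷ (_ , edge~vertex′ p₁p₂ , c-p₂) ∷ [])
    ; c₄ → inj₁ p₂ , c-p₂ , seesAllOthers c-p₂ (c₀ ∷ c₁ ∷ c₂ ∷ c₃ ∷ [])
             ((_ , vertex~edge p₂t , c-p₂t) ∷ (_ , vertex~vertex p₂t , c-t) ∷ (_ , vertex~vertex (Adj-sym p₁p₂) , c-p₁) ∷
              (_ , vertex~edge′ p₁p₂ , c-p₁p₂) ∷ [])
    }

module DoubleStar (G : Graph) (cat : IsCaterpillar G) (m≤5 : mT G ≤ 5) (s≡2 : Caterpillar.s G cat ≡ 2)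
                  (¬path : ¬ (Caterpillar.a G cat 0 ≡ 1 × Caterpillar.a G cat 1 ≡ 1)) where
  open Graph G using (n; adj)
  open Adjacency G
  open Caterpillar G cat
  open CaterpillarCode G cat
  open DoubleStarColouring (a 0) (a 1)

  private
    2≤s : 2 ≤ s
    2≤s = ≤-reflexive (sym s≡2)
    0<s : 0 < s
    0<s = <-trans (s≤s z≤n) 2≤s
    a₀≤3 : a 0 ≤ 3
    a₀≤3 = a-first≤3 m≤5 2≤s
    a₁≤3 : a 1 ≤ 3
    a₁≤3 = a-last≤3 m≤5 0 (sym s≡2)
    0<a₀ : 0 < a 0
    0<a₀ = 1≤a-first 2≤s
    0<a₁ : 0 < a 1
    0<a₁ = 1≤a-last 0 (sym s≡2)

  valid⇒W : ∀ {c} → Valid c → W c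
  valid⇒W {spineV _} i< = subst (_ <_) s≡2 i<
  valid⇒W {spineE _} i+1< = subst (_ <_) s≡2 i+1<
  valid⇒W {leafV zero _} (_ , r<) = s≤s z≤n , r<
  valid⇒W {leafV (suc zero) _} (_ , r<) = s≤s (s≤s z≤n) , r<
  valid⇒W {leafV (suc (suc _)) _} (i< , _) = contradiction (subst (_ <_) s≡2 i<) λ { (s≤s (s≤s ())) }
  valid⇒W {leafE zero _} (_ , r<) = s≤s z≤n , r<
  valid⇒W {leafE (suc zero) _} (_ , r<) = s≤s (s≤s z≤n) , r<
  valid⇒W {leafE (suc (suc _)) _} (i< , _) = contradiction (subst (_ <_) s≡2 i<) λ { (s≤s (s≤s ())) }

  open CodeColouring G cat 0<s W colour valid⇒W (colour-proper a₀≤3 a₁≤3)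

  p₀ p₁ : Fin n
  p₀ = p 0
  p₁ = p 1

  g h : ℕ → Element G
  g r = edgeOf p₀ (leaf 0 r)
  h r = edgeOf p₁ (leaf 1 r)

  p₀p₁ : adj p₀ p₁ ≡ true
  p₀p₁ = p-adj 2≤s

  c-p₀ : c (inj₁ p₀) ≡ c₀
  c-p₀ = cong colour (code-p 0<s)
  c-p₁ : c (inj₁ p₁) ≡ c₂
  c-p₁ = cong colour (code-p 2≤s)
  c-p₀p₁ : c (edgeOf p₀ p₁) ≡ c₁
  c-p₀p₁ = cong colour (code-spineEdge 2≤s)
  c-g : ∀ {r} → r < a 0 → c (g r) ≡ lookupOr c₁ (c₃ ∷ c₄ ∷ c₂ ∷ []) r
  c-g r< = cong colour (code-pendant 0<s r<)
  c-h : ∀ {r} → r < a 1 → c (h r) ≡ lookupOr c₁ (c₃ ∷ c₄ ∷ c₀ ∷ []) r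
  c-h r< = cong colour (code-pendant 2≤s r<)
  c-leaf₀ : ∀ {r} → r < a 0 → c (inj₁ (leaf 0 r)) ≡ leafColour c₂ (a 0) r
  c-leaf₀ r< = cong colour (code-leaf 0<s r<)
  c-leaf₁ : ∀ {r} → r < a 1 → c (inj₁ (leaf 1 r)) ≡ leafColour c₀ (a 1) r
  c-leaf₁ r< = cong colour (code-leaf 2≤s r<)

  p₀~g : ∀ {r} → r < a 0 → inj₁ p₀ ~ g r
  p₀~g r< = vertex~edge (leaf-adj r<)
  p₁~h : ∀ {r} → r < a 1 → inj₁ p₁ ~ h r
  p₁~h r< = vertex~edge (leaf-adj r<)
  p₀p₁~g : ∀ {r} → r < a 0 → edgeOf p₀ p₁ ~ g r
  p₀p₁~g r< = edge~edge p₀p₁ (leaf-adj r<) (p≢leaf 2≤s r<)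
  p₀p₁~h : ∀ {r} → r < a 1 → edgeOf p₀ p₁ ~ h r
  p₀p₁~h r< = edge~edge-path p₀p₁ (leaf-adj r<) (p≢leaf 0<s r<)
  g~g : ∀ {r r′} → r < a 0 → r′ < a 0 → r ≢ r′ → g r ~ g r′
  g~g r< r′< r≢r′ = edge~edge (leaf-adj r<) (leaf-adj r′<) (r≢r′ ∘ leaf-injective r< r′<)
  h~h : ∀ {r r′} → r < a 1 → r′ < a 1 → r ≢ r′ → h r ~ h r′
  h~h r< r′< r≢r′ = edge~edge (leaf-adj r<) (leaf-adj r′<) (r≢r′ ∘ leaf-injective r< r′<)

  ≤⇒≡⊎< : ∀ {k m} → k ≤ m → m ≡ k ⊎ k < m
  ≤⇒≡⊎< k≤m = Sum.swap (Sum.map₂ sym (m≤n⇒m<n∨m≡n k≤m))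

  leafColour-2 : ∀ other {r} → r < 2 → leafColour other 2 r ≡ other
  leafColour-2 other {zero} _ = refl
  leafColour-2 other {suc zero} _ = refl
  leafColour-2 other {suc (suc _)} (s≤s (s≤s ()))

  p₀-sees-4 : Sees (inj₁ p₀) c₄
  p₀-sees-4 with ≤⇒≡⊎< 0<a₀
  ... | inj₁ a≡1 = inj₁ (leaf 0 0) , vertex~vertex (leaf-adj 0<a₀) , trans (c-leaf₀ 0<a₀) (cong (λ m → leafColour c₂ m 0) a≡1)
  ... | inj₂ 1<a = g 1 , p₀~g 1<a , c-g 1<a

  p₁-sees-4 : Sees (inj₁ p₁) c₄
  p₁-sees-4 with ≤⇒≡⊎< 0<a₁
  ... | inj₁ a≡1 = inj₁ (leaf 1 0) , vertex~vertex (leaf-adj 0<a₁) , trans (c-leaf₁ 0<a₁) (cong (λ m → leafColour c₀ m 0) a≡1)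
  ... | inj₂ 1<a = h 1 , p₁~h 1<a , c-h 1<a

  -- Here the caterpillar not being a path is used.
  p₀p₁-sees-4 : Sees (edgeOf p₀ p₁) c₄
  p₀p₁-sees-4 with ≤⇒≡⊎< 0<a₀ | ≤⇒≡⊎< 0<a₁
  ... | inj₂ 1<a | _        = g 1 , p₀p₁~g 1<a , c-g 1<a
  ... | inj₁ _   | inj₂ 1<a = h 1 , p₀p₁~h 1<a , c-h 1<a
  ... | inj₁ a₀≡1 | inj₁ a₁≡1 = contradiction (a₀≡1 , a₁≡1) ¬path

  g-sees-2 : 1 < a 0 → ∀ r → r < 2 → Sees (g r) c₂
  g-sees-2 1<a r r<2 with ≤⇒≡⊎< 1<a
  ... | inj₁ a≡2 = inj₁ (leaf 0 r) , edge~vertex′ (leaf-adj r<a) ,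
                   trans (c-leaf₀ r<a) (trans (cong (λ m → leafColour c₂ m r) a≡2) (leafColour-2 c₂ r<2))
    where
    r<a : r < a 0
    r<a = subst (r <_) (sym a≡2) r<2
  ... | inj₂ 2<a = g 2 , g~g (<-trans r<2 2<a) 2<a (λ { refl → <-irrefl refl r<2 }) , c-g 2<a

  h-sees-0 : 1 < a 1 → ∀ r → r < 2 → Sees (h r) c₀
  h-sees-0 1<a r r<2 with ≤⇒≡⊎< 1<a
  ... | inj₁ a≡2 = inj₁ (leaf 1 r) , edge~vertex′ (leaf-adj r<a) ,
                   trans (c-leaf₁ r<a) (trans (cong (λ m → leafColour c₀ m r) a≡2) (leafColour-2 c₀ r<2))
    where
    r<a : r < a 1
    r<a = subst (r <_) (sym a≡2) r<2
  ... | inj₂ 2<a = h 2 , h~h (<-trans r<2 2<a) 2<a (λ { refl → <-irrefl refl r<2 }) , c-h 2<a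

  pendant-rainbows : Rainbow c₃ × Rainbow c₄
  pendant-rainbows with ≤⇒≡⊎< 0<a₀ | ≤⇒≡⊎< 0<a₁
  ... | inj₂ 1<a | _ =
      (g 0 , c-g 0<a₀ , seesAllOthers (c-g 0<a₀) (c₀ ∷ c₁ ∷ c₂ ∷ c₄ ∷ [])
         ((_ , edge~vertex (leaf-adj 0<a₀) , c-p₀) ∷ (_ , ~-sym (p₀p₁~g 0<a₀) , c-p₀p₁) ∷ g-sees-2 1<a 0 (s≤s z≤n) ∷
          (_ , g~g 0<a₀ 1<a (λ ()) , c-g 1<a) ∷ []))
    , (g 1 , c-g 1<a , seesAllOthers (c-g 1<a) (c₀ ∷ c₁ ∷ c₂ ∷ c₃ ∷ [])
         ((_ , edge~vertex (leaf-adj 1<a) , c-p₀) ∷ (_ , ~-sym (p₀p₁~g 1<a) , c-p₀p₁) ∷ g-sees-2 1<a 1 (s≤s (s≤s z≤n)) ∷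
          (_ , g~g 1<a 0<a₀ (λ ()) , c-g 0<a₀) ∷ []))
  ... | inj₁ _ | inj₂ 1<a =
      (h 0 , c-h 0<a₁ , seesAllOthers (c-h 0<a₁) (c₀ ∷ c₁ ∷ c₂ ∷ c₄ ∷ [])
         (h-sees-0 1<a 0 (s≤s z≤n) ∷ (_ , ~-sym (p₀p₁~h 0<a₁) , c-p₀p₁) ∷ (_ , edge~vertex (leaf-adj 0<a₁) , c-p₁) ∷
          (_ , h~h 0<a₁ 1<a (λ ()) , c-h 1<a) ∷ []))
    , (h 1 , c-h 1<a , seesAllOthers (c-h 1<a) (c₀ ∷ c₁ ∷ c₂ ∷ c₃ ∷ [])
         (h-sees-0 1<a 1 (s≤s (s≤s z≤n)) ∷ (_ , ~-sym (p₀p₁~h 1<a) , c-p₀p₁) ∷ (_ , edge~vertex (leaf-adj 1<a) , c-p₁) ∷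
          (_ , h~h 1<a 0<a₁ (λ ()) , c-h 0<a₁) ∷ []))
  ... | inj₁ a₀≡1 | inj₁ a₁≡1 = contradiction (a₀≡1 , a₁≡1) ¬path

  has5 : HasTotalBChromaticColouring G 5
  has5 = bChromaticColouring proper λ
    { c₀ → inj₁ p₀ , c-p₀ , seesAllOthers c-p₀ (c₁ ∷ c₂ ∷ c₃ ∷ c₄ ∷ [])
             ((_ , vertex~edge p₀p₁ , c-p₀p₁) ∷ (_ , vertex~vertex p₀p₁ , c-p₁) ∷ (_ , p₀~g 0<a₀ , c-g 0<a₀) ∷ p₀-sees-4 ∷ [])
    ; c₁ → edgeOf p₀ p₁ , c-p₀p₁ , seesAllOthers c-p₀p₁ (c₀ ∷ c₂ ∷ c₃ ∷ c₄ ∷ [])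
             ((_ , edge~vertex p₀p₁ , c-p₀) ∷ (_ , edge~vertex′ p₀p₁ , c-p₁) ∷ (_ , p₀p₁~g 0<a₀ , c-g 0<a₀) ∷ p₀p₁-sees-4 ∷ [])
    ; c₂ → inj₁ p₁ , c-p₁ , seesAllOthers c-p₁ (c₀ ∷ c₁ ∷ c₃ ∷ c₄ ∷ [])
             ((_ , vertex~vertex (Adj-sym p₀p₁) , c-p₀) ∷ (_ , vertex~edge′ p₀p₁ , c-p₀p₁) ∷ (_ , p₁~h 0<a₁ , c-h 0<a₁) ∷ p₁-sees-4 ∷ [])
    ; c₃ → proj₁ pendant-rainbows
    ; c₄ → proj₂ pendant-rainbows
    }

module P₄ (G : Graph) (cat : IsCaterpillar G) (s≡2 : Caterpillar.s G cat ≡ 2)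
             (a₀≡1 : Caterpillar.a G cat 0 ≡ 1) (a₁≡1 : Caterpillar.a G cat 1 ≡ 1) where
  open Graph G using (n; adj)
  open Elements G
  open MDegree G
  open Adjacency G
  open Caterpillar G cat
  open CaterpillarCode G cat
  open P₄Colouring

  private
    2≤s : 2 ≤ s
    2≤s = ≤-reflexive (sym s≡2)
    0<s : 0 < s
    0<s = <-trans (s≤s z≤n) 2≤s
    0<a₀ : 0 < a 0
    0<a₀ = subst (0 <_) (sym a₀≡1) (s≤s z≤n)
    0<a₁ : 0 < a 1
    0<a₁ = subst (0 <_) (sym a₁≡1) (s≤s z≤n)

  open NonEmpty 0<s

  valid⇒W : ∀ {c} → Valid c → W c
  valid⇒W {spineV _} i< = subst (_ <_) s≡2 i<
  valid⇒W {spineE _} i+1< = subst (_ <_) s≡2 i+1<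
  valid⇒W {leafV zero _} (_ , r<) = s≤s z≤n , subst (_ <_) a₀≡1 r<
  valid⇒W {leafV (suc zero) _} (_ , r<) = s≤s (s≤s z≤n) , subst (_ <_) a₁≡1 r<
  valid⇒W {leafV (suc (suc _)) _} (i< , _) = contradiction (subst (_ <_) s≡2 i<) λ { (s≤s (s≤s ())) }
  valid⇒W {leafE zero _} (_ , r<) = s≤s z≤n , subst (_ <_) a₀≡1 r<
  valid⇒W {leafE (suc zero) _} (_ , r<) = s≤s (s≤s z≤n) , subst (_ <_) a₁≡1 r<
  valid⇒W {leafE (suc (suc _)) _} (i< , _) = contradiction (subst (_ <_) s≡2 i<) λ { (s≤s (s≤s ())) }

  open CodeColouring G cat 0<s W colour valid⇒W colour-proper

  p₀ p₁ ℓ₀ ℓ₁ : Fin n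
  p₀ = p 0
  p₁ = p 1
  ℓ₀ = leaf 0 0
  ℓ₁ = leaf 1 0

  p₀p₁ : adj p₀ p₁ ≡ true
  p₀p₁ = p-adj 2≤s
  p₀ℓ₀ : adj p₀ ℓ₀ ≡ true
  p₀ℓ₀ = leaf-adj 0<a₀
  p₁ℓ₁ : adj p₁ ℓ₁ ≡ true
  p₁ℓ₁ = leaf-adj 0<a₁

  c-p₀ : c (inj₁ p₀) ≡ c₂
  c-p₀ = cong colour (code-p 0<s)
  c-p₁ : c (inj₁ p₁) ≡ c₀
  c-p₁ = cong colour (code-p 2≤s)
  c-p₀p₁ : c (edgeOf p₀ p₁) ≡ c₃
  c-p₀p₁ = cong colour (code-spineEdge 2≤s)
  c-p₀ℓ₀ : c (edgeOf p₀ ℓ₀) ≡ c₁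
  c-p₀ℓ₀ = cong colour (code-pendant 0<s 0<a₀)
  c-p₁ℓ₁ : c (edgeOf p₁ ℓ₁) ≡ c₁
  c-p₁ℓ₁ = cong colour (code-pendant 2≤s 0<a₁)
  c-ℓ₀ : c (inj₁ ℓ₀) ≡ c₀
  c-ℓ₀ = cong colour (code-leaf 0<s 0<a₀)
  c-ℓ₁ : c (inj₁ ℓ₁) ≡ c₂
  c-ℓ₁ = cong colour (code-leaf 2≤s 0<a₁)

  has4 : HasTotalBChromaticColouring G 4
  has4 = bChromaticColouring proper λ
    { c₀ → inj₁ p₁ , c-p₁ , seesAllOthers c-p₁ (c₁ ∷ c₂ ∷ c₃ ∷ [])
             ((_ , vertex~edge p₁ℓ₁ , c-p₁ℓ₁) ∷ (_ , vertex~vertex p₁ℓ₁ , c-ℓ₁) ∷ (_ , vertex~edge′ p₀p₁ , c-p₀p₁) ∷ [])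
    ; c₁ → edgeOf p₀ ℓ₀ , c-p₀ℓ₀ , seesAllOthers c-p₀ℓ₀ (c₀ ∷ c₂ ∷ c₃ ∷ [])
             ((_ , edge~vertex′ p₀ℓ₀ , c-ℓ₀) ∷ (_ , edge~vertex p₀ℓ₀ , c-p₀) ∷ (_ , edge~edge p₀ℓ₀ p₀p₁ (p≢leaf 2≤s 0<a₀ ∘ sym) , c-p₀p₁) ∷ [])
    ; c₂ → inj₁ p₀ , c-p₀ , seesAllOthers c-p₀ (c₀ ∷ c₁ ∷ c₃ ∷ [])
             ((_ , vertex~vertex p₀ℓ₀ , c-ℓ₀) ∷ (_ , vertex~edge p₀ℓ₀ , c-p₀ℓ₀) ∷ (_ , vertex~edge p₀p₁ , c-p₀p₁) ∷ [])
    ; c₃ → edgeOf p₀ p₁ , c-p₀p₁ , seesAllOthers c-p₀p₁ (c₀ ∷ c₁ ∷ c₂ ∷ [])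
             ((_ , edge~vertex′ p₀p₁ , c-p₁) ∷ (_ , edge~edge p₀p₁ p₀ℓ₀ (p≢leaf 2≤s 0<a₀) , c-p₀ℓ₀) ∷ (_ , edge~vertex p₀p₁ , c-p₀) ∷ [])
    }

  ∈P⇒p₀⊎p₁ : ∀ {v} → v ∈ P → v ≡ p₀ ⊎ v ≡ p₁
  ∈P⇒p₀⊎p₁ v∈ with ∈P⇒≡p v∈
  ... | zero , _ , v≡ = inj₁ v≡
  ... | suc zero , _ , v≡ = inj₂ v≡
  ... | suc (suc _) , i< , _ = contradiction (subst (_ <_) s≡2 i<) λ { (s≤s (s≤s ())) }

  deg≤2 : ∀ {v} → v ∈ P → deg G v ≤ 2
  deg≤2 v∈ with ∈P⇒p₀⊎p₁ v∈
  ... | inj₁ refl = ≤-reflexive (trans (deg-first 2≤s) (cong suc a₀≡1))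
  ... | inj₂ refl = ≤-reflexive (trans (deg-last 0 (sym s≡2)) (cong suc a₁≡1))

  -- Only p₀, p₁ and p₀p₁ have total degree at least 4.
  mT≤4 : mT G ≤ 4
  mT≤4 = mT-≤ 4 {inj₁ p₀ ∷ inj₁ p₁ ∷ edgeOf p₀ p₁ ∷ []} (s≤s (s≤s (s≤s z≤n))) big
    where
    big : ∀ {x} → 4 ≤ degT G x → x ∈ inj₁ p₀ ∷ inj₁ p₁ ∷ edgeOf p₀ p₁ ∷ []
    big {x} 4≤ with kind x
    ... | spine-vertex v∈ refl with ∈P⇒p₀⊎p₁ v∈
    ...   | inj₁ refl = here refl
    ...   | inj₂ refl = there (here refl)
    big 4≤ | leaf-vertex v∉ refl = contradiction (≤-trans 4≤ (degT-leaf v∉)) λ { (s≤s (s≤s ())) }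
    big 4≤ | spine-edge u∈ v∈ uv refl with ∈P⇒p₀⊎p₁ u∈ | ∈P⇒p₀⊎p₁ v∈
    ... | inj₁ refl | inj₁ refl = contradiction refl (Adj⇒≢ uv)
    ... | inj₁ refl | inj₂ refl = there (there (here refl))
    ... | inj₂ refl | inj₁ refl = there (there (here (edgeOf-comm uv)))
    ... | inj₂ refl | inj₂ refl = contradiction refl (Adj⇒≢ uv)
    big 4≤ | pendant-edge u∈ w∉ uw refl =
      contradiction (≤-trans 4≤ (≤-trans (degT-pendant w∉ uw) (s≤s (deg≤2 u∈)))) λ { (s≤s (s≤s (s≤s ()))) }

module Star (G : Graph) (cat : IsCaterpillar G) (s≡1 : Caterpillar.s G cat ≡ 1) where
  open Graph G using (n; adj)
  open Elements G
  open MDegree G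
  open Adjacency G
  open Caterpillar G cat
  open CaterpillarCode G cat

  private
    0<s : 0 < s
    0<s = ≤-reflexive (sym s≡1)

  open NonEmpty 0<s

  centre : Fin n
  centre = p 0

  2≤a : 2 ≤ a 0
  2≤a = subst (2 ≤_) (deg-star s≡1) (∈P⇒deg≥2 (p∈P 0<s))

  open StarColouring (a 0)

  valid⇒W : ∀ {c} → Valid c → W c
  valid⇒W {spineV _} i< = subst (_ <_) s≡1 i<
  valid⇒W {spineE _} i+1< = subst (_ <_) s≡1 i+1<
  valid⇒W {leafV zero _} (_ , r<) = s≤s z≤n , r<
  valid⇒W {leafV (suc _) _} (i< , _) = contradiction (subst (_ <_) s≡1 i<) λ { (s≤s ()) }
  valid⇒W {leafE zero _} (_ , r<) = s≤s z≤n , r<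
  valid⇒W {leafE (suc _) _} (i< , _) = contradiction (subst (_ <_) s≡1 i<) λ { (s≤s ()) }

  open CodeColouring G cat 0<s W colour valid⇒W (colour-proper 2≤a)

  pendant : Fin (a 0) → Element G
  pendant j = edgeOf centre (leaf 0 (toℕ j))

  centre~pendant : ∀ j → adj centre (leaf 0 (toℕ j)) ≡ true
  centre~pendant j = leaf-adj (toℕ<n j)

  c-centre : c (inj₁ centre) ≡ c₀
  c-centre = cong colour (code-p 0<s)

  c-pendant : ∀ j → c (pendant j) ≡ suc j
  c-pendant j = toℕ-injective (trans (cong (toℕ ∘ colour) (code-pendant 0<s (toℕ<n j))) (toℕ-mod (toℕ<n j)))

  hasStar : HasTotalBChromaticColouring G (suc (a 0))
  hasStar = bChromaticColouring proper λ
    { zero    → inj₁ centre , c-centre , centre-sees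
    ; (suc j) → pendant j , c-pendant j , pendant-sees j
    }
    where
    centre-sees : SeesAllOthers (inj₁ centre)
    centre-sees zero    0≢0 = contradiction (sym c-centre) 0≢0
    centre-sees (suc j) _   = pendant j , vertex~edge (centre~pendant j) , c-pendant j
    pendant-sees : ∀ j → SeesAllOthers (pendant j)
    pendant-sees j zero    _   = inj₁ centre , edge~vertex (centre~pendant j) , c-centre
    pendant-sees j (suc i) i≢j = pendant i , edge~edge (centre~pendant j) (centre~pendant i) distinct , c-pendant i
      where
      distinct : leaf 0 (toℕ j) ≢ leaf 0 (toℕ i)
      distinct eq = i≢j (trans (cong suc (toℕ-injective (sym (leaf-injective (toℕ<n j) (toℕ<n i) eq)))) (sym (c-pendant j)))

  -- Only the centre and the pendant edges have total degree at least a₀ + 1 ≥ 3.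
  mT≤ : mT G ≤ suc (a 0)
  mT≤ = mT-≤ (suc (a 0)) {inj₁ centre ∷ map pendant (allFin (a 0))}
    (≤-reflexive (cong suc (trans (length-map pendant (allFin (a 0))) (length-tabulate id)))) big
    where
    only-centre : ∀ {v} → v ∈ P → v ≡ centre
    only-centre v∈ with ∈P⇒≡p v∈
    ... | zero , _ , v≡ = v≡
    ... | suc _ , i< , _ = contradiction (subst (_ <_) s≡1 i<) λ { (s≤s ()) }
    big : ∀ {x} → suc (a 0) ≤ degT G x → x ∈ inj₁ centre ∷ map pendant (allFin (a 0))
    big {x} a< with kind x
    ... | spine-vertex v∈ refl = here (cong inj₁ (only-centre v∈))
    ... | leaf-vertex v∉ refl = contradiction (≤-trans (s≤s 2≤a) (≤-trans a< (degT-leaf v∉))) λ { (s≤s (s≤s ())) }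
    ... | spine-edge u∈ v∈ uv refl = contradiction (trans (only-centre u∈) (sym (only-centre v∈))) (Adj⇒≢ uv)
    ... | pendant-edge u∈ w∉ uw refl with refl ← only-centre u∈ with r< , leaf≡ ← leaf-rank w∉ uw =
      there (subst (_∈ map pendant (allFin (a 0))) (cong (edgeOf centre) (trans (cong (leaf 0) (toℕ-fromℕ< r<)) leaf≡))
                   (∈-map⁺ pendant (∈-allFin (Fin.fromℕ< r<))))

-- A caterpillar without spine vertices is K₁ or K₂.
module NoSpine (G : Graph) (cat : IsCaterpillar G) (s≡0 : Caterpillar.s G cat ≡ 0) where
  open Graph G using (n; adj)
  open Elements G
  open MDegree G
  open Adjacency G
  open Caterpillar G cat

  ∉P : ∀ v → v ∉ P
  ∉P v v∈ = contradiction (subst (index v <_) s≡0 (index-< v∈)) λ ()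

  Attained : Set
  Attained = ∃[ k ] HasTotalBChromaticColouring G k × mT G ≤ k

  module K₁ (v₀-isolated : ∀ w → adj v₀ w ≢ true) where

    colour : Element G → Fin 1
    colour _ = c₀

    open BChromatic G colour

    all-v₀ : ∀ u → u ≡ v₀
    all-v₀ u with proj₂ connected v₀ u
    ... | [] , _ , v₀≡u = sym v₀≡u
    ... | w ∷ _ , (_ , v₀w ∷ _) , _ = contradiction v₀w (v₀-isolated w)

    no-edge : ∀ {u v} → adj u v ≢ true
    no-edge {u} {v} uv = Adj⇒≢ uv (trans (all-v₀ u) (sym (all-v₀ v)))

    proper : ∀ {x y} → x ~ y → colour x ≢ colour y
    proper (vertex~vertex uv)  = contradiction uv no-edge
    proper (vertex~edge uv)    = contradiction uv no-edge
    proper (edge~vertex uv)    = contradiction uv no-edge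
    proper (edge~edge uv _ _)  = contradiction uv no-edge

    only-v₀ : ∀ {x} → 1 ≤ degT G x → x ∈ inj₁ v₀ ∷ []
    only-v₀ {inj₁ u} _ = here (cong inj₁ (all-v₀ u))
    only-v₀ {inj₂ ((u , v) , _ , uv)} _ = contradiction uv no-edge

    attained : Attained
    attained = 1 , bChromaticColouring proper (λ { c₀ → inj₁ v₀ , refl , λ { c₀ 0≢0 → contradiction refl 0≢0 } }) ,
               mT-≤ 1 (s≤s z≤n) only-v₀

  module K₂ {v₁} (v₀v₁ : adj v₀ v₁ ≡ true) where

    colour : Element G → Fin 3
    colour (inj₁ v) with v Fin.≟ v₀
    ... | yes _ = c₀
    ... | no _  = c₁
    colour (inj₂ _) = c₂

    open BChromatic G colour

    v₀-or-v₁ : ∀ u → u ≡ v₀ ⊎ u ≡ v₁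
    v₀-or-v₁ u with proj₂ connected v₀ u
    ... | [] , _ , v₀≡u = inj₁ (sym v₀≡u)
    ... | w ∷ [] , (_ , v₀w ∷ _) , w≡u = inj₂ (trans (sym w≡u) (∉P-adj-unique (∉P v₀) v₀w v₀v₁))
    ... | w ∷ w′ ∷ _ , ((v₀∉ ∷ _) , v₀w ∷ ww′ ∷ _) , _
      with refl ← ∉P-adj-unique (∉P v₀) v₀w v₀v₁ =
      contradiction (sym (∉P-adj-unique (∉P v₁) ww′ (Adj-sym v₀v₁))) (All.lookup v₀∉ (there (here refl)))

    colour-v₀ : colour (inj₁ v₀) ≡ c₀
    colour-v₀ with v₀ Fin.≟ v₀
    ... | yes _    = refl
    ... | no v₀≢v₀ = contradiction refl v₀≢v₀

    colour-v₁ : colour (inj₁ v₁) ≡ c₁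
    colour-v₁ with v₁ Fin.≟ v₀
    ... | yes v₁≡v₀ = contradiction (sym v₁≡v₀) (Adj⇒≢ v₀v₁)
    ... | no _      = refl

    colour-edge : ∀ {u v} → adj u v ≡ true → colour (edgeOf u v) ≡ c₂
    colour-edge uv with _ , eq , _ ← edgeOf-≡ uv rewrite eq = refl

    colour-vertex≢c₂ : ∀ u → colour (inj₁ u) ≢ c₂
    colour-vertex≢c₂ u with u Fin.≟ v₀
    ... | yes _ = λ ()
    ... | no _  = λ ()

    proper : ∀ {x y} → x ~ y → colour x ≢ colour y
    proper (vertex~vertex {u} {v} uv) with v₀-or-v₁ u | v₀-or-v₁ v
    ... | inj₁ refl | inj₂ refl = λ eq → contradiction (trans (sym colour-v₀) (trans eq colour-v₁)) λ ()
    ... | inj₂ refl | inj₁ refl = λ eq → contradiction (trans (sym colour-v₁) (trans eq colour-v₀)) λ ()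
    ... | inj₁ refl | inj₁ refl = contradiction refl (Adj⇒≢ uv)
    ... | inj₂ refl | inj₂ refl = contradiction refl (Adj⇒≢ uv)
    proper (vertex~edge {u} uv) rewrite colour-edge uv = colour-vertex≢c₂ u
    proper (edge~vertex {u} uv) rewrite colour-edge uv = colour-vertex≢c₂ u ∘ sym
    proper (edge~edge {u} uv uw v≢w) = contradiction (∉P-adj-unique (∉P u) uv uw) v≢w

    rainbow : ∀ j → Rainbow j
    rainbow c₀ = inj₁ v₀ , colour-v₀ , seesAllOthers colour-v₀ (c₁ ∷ c₂ ∷ [])
                   ((_ , vertex~vertex v₀v₁ , colour-v₁) ∷ (_ , vertex~edge v₀v₁ , colour-edge v₀v₁) ∷ [])
    rainbow c₁ = inj₁ v₁ , colour-v₁ , seesAllOthers colour-v₁ (c₀ ∷ c₂ ∷ [])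
                   ((_ , vertex~vertex (Adj-sym v₀v₁) , colour-v₀) ∷ (_ , vertex~edge′ v₀v₁ , colour-edge v₀v₁) ∷ [])
    rainbow c₂ = edgeOf v₀ v₁ , colour-edge v₀v₁ , seesAllOthers (colour-edge v₀v₁) (c₀ ∷ c₁ ∷ [])
                   ((_ , edge~vertex v₀v₁ , colour-v₀) ∷ (_ , edge~vertex′ v₀v₁ , colour-v₁) ∷ [])

    only-K₂ : ∀ {x} → 3 ≤ degT G x → x ∈ inj₁ v₀ ∷ inj₁ v₁ ∷ edgeOf v₀ v₁ ∷ []
    only-K₂ {inj₁ u} _ with v₀-or-v₁ u
    ... | inj₁ refl = here refl
    ... | inj₂ refl = there (here refl)
    only-K₂ {inj₂ e@((u , v) , _ , uv)} _ rewrite inj₂≡edgeOf e with v₀-or-v₁ u | v₀-or-v₁ v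
    ... | inj₁ refl | inj₂ refl = there (there (here refl))
    ... | inj₂ refl | inj₁ refl = there (there (here (edgeOf-comm uv)))
    ... | inj₁ refl | inj₁ refl = contradiction refl (Adj⇒≢ uv)
    ... | inj₂ refl | inj₂ refl = contradiction refl (Adj⇒≢ uv)

    attained : Attained
    attained = 3 , bChromaticColouring proper rainbow , mT-≤ 3 (s≤s (s≤s (s≤s z≤n))) only-K₂

  attained : Attained
  attained with Fin.any? (λ w → adj v₀ w Bool.≟ true)
  ... | yes (_ , v₀v₁) = K₂.attained v₀v₁
  ... | no ¬edge       = K₁.attained λ w v₀w → ¬edge (w , v₀w)

attained : ∀ (T : Graph) (cat : IsCaterpillar T) → mT T ≤ 5 → ∃[ k ] HasTotalBChromaticColouring T k × mT T ≤ k
attained T cat m≤5 with Caterpillar.s T cat in s≡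
... | 0 = NoSpine.attained T cat s≡
... | 1 = suc (a 0) , Star.hasStar T cat s≡ , Star.mT≤ T cat s≡
  where open Caterpillar T cat using (a)
... | 2 with Caterpillar.a T cat 0 ≟ 1 | Caterpillar.a T cat 1 ≟ 1
...   | yes a₀≡1 | yes a₁≡1 = 4 , P₄.has4 T cat s≡ a₀≡1 a₁≡1 , P₄.mT≤4 T cat s≡ a₀≡1 a₁≡1
...   | no a₀≢1  | _        = 5 , DoubleStar.has5 T cat m≤5 s≡ (a₀≢1 ∘ proj₁) , m≤5
...   | yes _    | no a₁≢1  = 5 , DoubleStar.has5 T cat m≤5 s≡ (a₁≢1 ∘ proj₂) , m≤5
attained T cat m≤5 | suc (suc (suc _)) = 5 , LongSpine.has5 T cat m≤5 (subst (3 ≤_) (sym s≡) (s≤s (s≤s (s≤s z≤n)))) , m≤5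

theorem2 : (T : Graph) → IsCaterpillar T → mT T ≤ 5 → TotalBChromaticNumberIs T (mT T)
theorem2 T cat m≤5 with k , has-k , mT≤k ← attained T cat m≤5 =
  subst (HasTotalBChromaticColouring T) (≤-antisym (φt≤mT k has-k) mT≤k) has-k , φt≤mT
  where open MDegree T
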